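{- Let $p$ be any pattern in the symmetry class of one of $(123,\emptyset,\{0,1,2\})$, $(123,\emptyset,\{0,1,3\})$, $(132,\emptyset,\{0,1,2\})$, $(132,\emptyset,\{0,1,3\})$, $(132,\emptyset,\{0,2,3\})$, $(132,\emptyset,\{1,2,3\})$. Then for all $n\ge 3$, $a_n(p)=\frac56\, n!$.
   Context: A bi-vincular pattern of length $k$ is a triple $p=(\sigma,X,Y)$ with $\sigma$ a permutation of $[k]$ in one-line notation and $X,Y\subseteq\{0,1,\dots,k\}$. A permutation $\pi=\pi_1\cdots\pi_n$ of $[n]$ contains $p$ if there are indices $1\le i_1<\dots<i_k\le n$ such that $(\pi_{i_1},\dots,\pi_{i_k})$ is order-isomorphic to $\sigma$ and, writing $j_1<\dots<j_k$ for the set $\{\pi_{i_1},\dots,\pi_{i_k}\}$ in increasing order and setting $i_0=j_0=0$, $i_{k+1}=j_{k+1}=n+1$, we have $i_{x+1}=i_x+1$ for all $x\in X$ and $j_{y+1}=j_y+1$ for all $y\in Y$. Otherwise $\pi$ avoids $p$; $a_n(p)$ is the number of permutations of $[n]$ avoiding $p$. For $p=(\sigma,X,Y)$ of length $k$ define $p^{i}=(\sigma^{ -1},Y,X)$, $p^{r}=(\sigma^{r},\{k-x:x\in X\},Y)$, $p^{c}=(\sigma^{c},X,\{k-y:y\in Y\})$, with $\sigma^r_m=\sigma_{k+1-m}$ and $\sigma^c_m=k+1-\sigma_m$; the symmetry class of $p$ is the set of patterns obtained from $p$ by finite compositions of $i,r,c$. -}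

module Defs where

open import Data.Bool using (Bool; true; false; _∧_; _∨_; not; if_then_else_)
open import Data.Nat using (ℕ; zero; suc; _+_; _*_; _∸_; _≤_; _≡ᵇ_; _<ᵇ_; _≤ᵇ_)
open import Data.Nat.Properties using (≤-decTotalOrder)
open import Data.Fin using (Fin; toℕ; opposite)
open import Data.Fin.Subset using (Subset)
open import Data.Vec using (Vec; lookup; reverse) renaming (map to vmap; toList to vtoList)
open import Data.List using (List; []; _∷_; length; filterᵇ; map; concatMap; upTo)
open import Data.Bool.ListAction using (all; any; and)
open import Data.List.Sort.InsertionSort.Base ≤-decTotalOrder using (sort)
open import Relation.Binary.PropositionalEquality using (_≡_)

-- Bi-vincular patterns of length k.
-- σ : Vec (Fin k) k is the one-line notation with values shifted to 0..k-1
-- (value m+1 of the paper is stored as the Fin k element m).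
-- X , Y : subsets of {0,…,k}, represented as Subset (suc k)
-- (the Fin (suc k) element x stands for the number x).

record Pattern (k : ℕ) : Set where
  constructor pat
  field
    σ : Vec (Fin k) k
    X : Subset (suc k)
    Y : Subset (suc k)

open Pattern public

-- p^r = (σ^r, {k - x : x ∈ X}, Y)
rev : ∀ {k} → Pattern k → Pattern k
rev p = pat (reverse (σ p)) (reverse (X p)) (Y p)

-- p^c = (σ^c, X, {k - y : y ∈ Y});  σ^c_m = k+1-σ_m  (0-based: opposite)
comp : ∀ {k} → Pattern k → Pattern k
comp p = pat (vmap opposite (σ p)) (X p) (reverse (Y p))

IsInverseOf : ∀ {k} → Pattern k → Pattern k → Set
IsInverseOf q p =
  (∀ m → lookup (σ q) (lookup (σ p) m) ≡ m) × (X q ≡ Y p) × (Y q ≡ X p)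
  where open import Data.Product using (_×_)

data SymClass {k : ℕ} (b : Pattern k) : Pattern k → Set where
  base : SymClass b b
  byI  : ∀ {p q} → SymClass b p → IsInverseOf q p → SymClass b q
  byR  : ∀ {p} → SymClass b p → SymClass b (rev p)
  byC  : ∀ {p} → SymClass b p → SymClass b (comp p)

at : {A : Set} → A → List A → ℕ → A
at d []       _       = d
at d (x ∷ xs) zero    = x
at d (x ∷ xs) (suc i) = at d xs i

seqs : ℕ → ℕ → List (List ℕ)
seqs n zero    = [] ∷ []
seqs n (suc m) = concatMap (λ a → map (a ∷_) (seqs n m)) (upTo n)

strictlyIncreasing : List ℕ → Bool
strictlyIncreasing []           = true
strictlyIncreasing (a ∷ [])     = true
strictlyIncreasing (a ∷ b ∷ xs) = (a <ᵇ b) ∧ strictlyIncreasing (b ∷ xs)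

distinct : List ℕ → Bool
distinct []       = true
distinct (a ∷ xs) = not (any (λ b → a ≡ᵇ b) xs) ∧ distinct xs

-- A permutation of [n] is stored 0-based: a list of length n with entries
-- in {0,…,n-1} that are pairwise distinct (π_i of the paper = entry i-1 plus 1).
isPerm : ℕ → List ℕ → Bool
isPerm n π = (length π ≡ᵇ n) ∧ all (λ a → a <ᵇ n) π ∧ distinct π

-- The occurrence test for a fixed choice of (0-based) positions `idx`
-- (idx = (i_1 - 1, …, i_k - 1)).
occurrenceAt : ∀ {k} → (n : ℕ) → List ℕ → Pattern k → List ℕ → Bool
occurrenceAt {k} n π p idx =
  strictlyIncreasing idx ∧ orderIso ∧ adjX ∧ adjY
  where
    sig : List ℕ
    sig = map toℕ (vtoList (σ p))
    vals : List ℕ              -- (π_{i_1}, …, π_{i_k}), 0-based values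
    vals = map (at 0 π) idx
    ks : List ℕ
    ks = upTo k
    orderIso : Bool
    orderIso = and (concatMap (λ a → map (λ b →
      ((at 0 vals a <ᵇ at 0 vals b) ∧ (at 0 sig a <ᵇ at 0 sig b)) ∨
      (not (at 0 vals a <ᵇ at 0 vals b) ∧ not (at 0 sig a <ᵇ at 0 sig b))) ks) ks)
    -- 1-based i_x with i_0 = 0, i_{k+1} = n+1
    I : ℕ → ℕ
    I zero    = 0
    I (suc x) = if x <ᵇ k then suc (at 0 idx x) else suc n
    sorted : List ℕ
    sorted = sort vals
    -- 1-based j_y (the y-th smallest chosen value) with j_0 = 0, j_{k+1} = n+1
    J : ℕ → ℕ
    J zero    = 0
    J (suc y) = if y <ᵇ k then suc (at 0 sorted y) else suc n
    xs : List ℕ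
    xs = upTo (suc k)
    adjX : Bool
    adjX = all (λ x → not (at false (vtoList (X p)) x) ∨ (I (suc x) ≡ᵇ suc (I x))) xs
    adjY : Bool
    adjY = all (λ y → not (at false (vtoList (Y p)) y) ∨ (J (suc y) ≡ᵇ suc (J y))) xs

contains : ∀ {k} → (n : ℕ) → List ℕ → Pattern k → Bool
contains {k} n π p = any (occurrenceAt n π p) (seqs n k)

avoiders : ∀ {k} → ℕ → Pattern k → ℕ
avoiders n p = length (filterᵇ (λ π → isPerm n π ∧ not (contains n π p)) (seqs n n))

sub4 : Bool → Bool → Bool → Bool → Subset 4
sub4 a b c d = a Vec.∷ b Vec.∷ c Vec.∷ d Vec.∷ Vec.[]
  where import Data.Vec as Vec

s123 s132 : Vec (Fin 3) 3
s123 = Fin.zero Vec.∷ Fin.suc Fin.zero Vec.∷ Fin.suc (Fin.suc Fin.zero) Vec.∷ Vec.[]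
  where import Data.Vec as Vec ; import Data.Fin as Fin
s132 = Fin.zero Vec.∷ Fin.suc (Fin.suc Fin.zero) Vec.∷ Fin.suc Fin.zero Vec.∷ Vec.[]
  where import Data.Vec as Vec ; import Data.Fin as Fin

∅ : Subset 4
∅ = sub4 false false false false

-- (123, ∅, {0,1,2}), (123, ∅, {0,1,3}), (132, ∅, {0,1,2}),
-- (132, ∅, {0,1,3}), (132, ∅, {0,2,3}), (132, ∅, {1,2,3})
p1 p2 p3 p4 p5 p6 : Pattern 3
p1 = pat s123 ∅ (sub4 true true true false)
p2 = pat s123 ∅ (sub4 true true false true)
p3 = pat s132 ∅ (sub4 true true true false)
p4 = pat s132 ∅ (sub4 true true false true)
p5 = pat s132 ∅ (sub4 true false true true)
p6 = pat s132 ∅ (sub4 false true true true)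

InTheSixClasses : Pattern 3 → Set
InTheSixClasses p =
  SymClass p1 p ⊎ SymClass p2 p ⊎ SymClass p3 p ⊎
  SymClass p4 p ⊎ SymClass p5 p ⊎ SymClass p6 p
  where open import Data.Sum using (_⊎_)

module Submission where

-- Call the sets {0,1,2}, {0,1,3}, {0,2,3}, {1,2,3} shapes.  In [n] the
-- adjacency constraints of a shape admit a single triple (`forced`).  If a
-- shape constrains the values and the positions are free (`valuePattern`),
-- π contains the pattern iff the three forced values occur in π in the order σ,
-- i.e. a fixed word of three distinct letters is a subword of π; exactly one
-- permutation in 3! = 6 has it (`count-fresh-subword`).  If a shape constrains
-- the positions and the values are free (`positionPattern`), π contains the
-- pattern iff its entries at the forced positions are in relative order σ;
-- choosing these entries first gives (#triples in order σ) · (n-3)!, and each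
-- of the six relative orders is taken by equally many triples
-- (`six-increasing`).  The six base patterns are value patterns and i, r, c
-- preserve the union of both families (`symClass-covered`), so one permutation
-- in six contains p, and 6 · a_n(p) = 5 · n!.

open import Defs
open import Data.Nat using (ℕ; _≤_; _*_; _!)
open import Relation.Binary.PropositionalEquality using (_≡_)

open import Data.Nat using (zero; suc; _+_; _∸_; _<_; _<ᵇ_; _≡ᵇ_; _≤ᵇ_; z≤n; s≤s; s≤s⁻¹)
open import Data.Nat.Properties
open import Algebra.Properties.CommutativeSemigroup +-commutativeSemigroup using (interchange)
open import Data.Bool using (Bool; true; false; _∧_; _∨_; not; if_then_else_; T)
open import Data.Bool.Properties using (∧-conicalˡ; ∧-conicalʳ; ∧-identityʳ; ∧-zeroʳ; ∨-identityʳ; ∨-zeroʳ; ∨-assoc; ∨-comm)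
open import Data.Bool.ListAction using (all; any; and)
open import Data.List using (List; []; _∷_; map; concatMap; upTo; length; _++_; filterᵇ; _∷ʳ_)
open import Data.List.Properties using (upTo-∷ʳ; concatMap-++; ++-identityʳ; map-cong)
open import Data.Nat.ListAction using (sum)
open import Relation.Binary.Definitions using (tri<; tri≈; tri>)
open import Data.List.Sort.InsertionSort.Base ≤-decTotalOrder using (sort; insert)
open import Data.Fin using (Fin; toℕ)
import Data.Fin as F
open import Data.Fin.Subset using (Subset)
open import Data.Vec using (Vec) renaming (toList to vtoList)
import Data.Vec as V
open import Data.Product using (Σ-syntax; _×_; _,_; proj₁; proj₂)
open import Data.Sum using (_⊎_; inj₁; inj₂)
open import Data.Empty using (⊥-elim)
open import Relation.Nullary using (¬_; contradiction)
open import Relation.Binary.PropositionalEquality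
  using (_≢_; ≢-sym; refl; sym; trans; cong; cong₂; subst; module ≡-Reasoning)

ind : Bool → ℕ
ind true  = 1
ind false = 0

ind-not : ∀ b → ind (not b) + ind b ≡ 1
ind-not true  = refl
ind-not false = refl

false≢true : false ≢ true
false≢true ()

-- Tests are handled as equations b ≡ true; the library states reflection via T b.
T⇒≡true : ∀ {b} → T b → b ≡ true
T⇒≡true {true} _ = refl

≡true⇒T : ∀ {b} → b ≡ true → T b
≡true⇒T refl = _

bool-ext : ∀ {b c} → (b ≡ true → c ≡ true) → (c ≡ true → b ≡ true) → b ≡ c
bool-ext {true}  {true}  _ _ = refl
bool-ext {true}  {false} f _ = sym (f refl)
bool-ext {false} {true}  _ g = g refl
bool-ext {false} {false} _ _ = refl

∧-intro : ∀ {a b} → a ≡ true → b ≡ true → (a ∧ b) ≡ true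
∧-intro refl h = h

∨-elim : ∀ p q → (p ∨ q) ≡ true → p ≡ true ⊎ q ≡ true
∨-elim true  _ _ = inj₁ refl
∨-elim false _ h = inj₂ h

not∧-elim : ∀ a b → (not a ∧ b) ≡ true → a ≡ false × b ≡ true
not∧-elim false b h = refl , h

<ᵇ-true : ∀ {a b} → a < b → (a <ᵇ b) ≡ true
<ᵇ-true a<b = T⇒≡true (<⇒<ᵇ a<b)

<ᵇ-false : ∀ {a b} → ¬ a < b → (a <ᵇ b) ≡ false
<ᵇ-false {a} {b} a≮b with a <ᵇ b in e
... | false = refl
... | true  = contradiction (<ᵇ⇒< a b (≡true⇒T e)) a≮b

<ᵇ-sound : ∀ a b → (a <ᵇ b) ≡ true → a < b
<ᵇ-sound a b e = <ᵇ⇒< a b (≡true⇒T e)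

≡ᵇ-true : ∀ {a b} → a ≡ b → (a ≡ᵇ b) ≡ true
≡ᵇ-true {a} {b} a≡b = T⇒≡true (≡⇒≡ᵇ a b a≡b)

≡ᵇ-false : ∀ {a b} → a ≢ b → (a ≡ᵇ b) ≡ false
≡ᵇ-false {a} {b} a≢b with a ≡ᵇ b in e
... | false = refl
... | true  = contradiction (≡ᵇ⇒≡ a b (≡true⇒T e)) a≢b

≡ᵇ-sound : ∀ a b → (a ≡ᵇ b) ≡ true → a ≡ b
≡ᵇ-sound a b e = ≡ᵇ⇒≡ a b (≡true⇒T e)

≡ᵇ-refl : ∀ a → (a ≡ᵇ a) ≡ true
≡ᵇ-refl a = ≡ᵇ-true {a} refl

≡ᵇ-sym : ∀ a b → (a ≡ᵇ b) ≡ (b ≡ᵇ a)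
≡ᵇ-sym a b = bool-ext (λ e → ≡ᵇ-true (sym (≡ᵇ-sound a b e)))
                      (λ e → ≡ᵇ-true (sym (≡ᵇ-sound b a e)))

Σn : ℕ → (ℕ → ℕ) → ℕ
Σn zero    f = 0
Σn (suc n) f = Σn n f + f n

Σ-cong : ∀ n {f g : ℕ → ℕ} → (∀ a → a < n → f a ≡ g a) → Σn n f ≡ Σn n g
Σ-cong zero    h = refl
Σ-cong (suc n) h = cong₂ _+_ (Σ-cong n (λ a a<n → h a (m<n⇒m<1+n a<n))) (h n (n<1+n n))

Σ-zero : ∀ n {f : ℕ → ℕ} → (∀ a → a < n → f a ≡ 0) → Σn n f ≡ 0
Σ-zero zero    h = refl
Σ-zero (suc n) h = cong₂ _+_ (Σ-zero n (λ a a<n → h a (m<n⇒m<1+n a<n))) (h n (n<1+n n))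

Σ-const : ∀ n k → Σn n (λ _ → k) ≡ n * k
Σ-const zero    k = refl
Σ-const (suc n) k = trans (cong (_+ k) (Σ-const n k)) (+-comm (n * k) k)

Σ-+ : ∀ n (f g : ℕ → ℕ) → Σn n (λ a → f a + g a) ≡ Σn n f + Σn n g
Σ-+ zero    f g = refl
Σ-+ (suc n) f g = trans (cong (_+ (f n + g n)) (Σ-+ n f g)) (interchange (Σn n f) (Σn n g) (f n) (g n))

Σ-*r : ∀ n (f : ℕ → ℕ) c → Σn n (λ a → f a * c) ≡ Σn n f * c
Σ-*r zero    f c = refl
Σ-*r (suc n) f c = trans (cong (_+ f n * c) (Σ-*r n f c)) (sym (*-distribʳ-+ c (Σn n f) (f n)))

Σ-*l : ∀ n (f : ℕ → ℕ) c → Σn n (λ a → c * f a) ≡ c * Σn n f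
Σ-*l n f c = trans (Σ-cong n (λ a _ → *-comm c (f a))) (trans (Σ-*r n f c) (*-comm (Σn n f) c))

Σ-swap : ∀ n k (f : ℕ → ℕ → ℕ) → Σn n (λ a → Σn k (f a)) ≡ Σn k (λ b → Σn n (λ a → f a b))
Σ-swap zero    k f = sym (Σ-zero k (λ _ _ → refl))
Σ-swap (suc n) k f = trans (cong (_+ Σn k (f n)) (Σ-swap n k f)) (sym (Σ-+ k (λ b → Σn n (λ a → f a b)) (f n)))

Σ-ind≤ : ∀ n (f : ℕ → Bool) → Σn n (λ a → ind (f a)) ≤ n
Σ-ind≤ zero    f = z≤n
Σ-ind≤ (suc n) f with f n
... | true  = subst (_≤ suc n) (sym (+-comm _ 1)) (s≤s (Σ-ind≤ n f))
... | false = subst (_≤ suc n) (sym (+-identityʳ _)) (m≤n⇒m≤1+n (Σ-ind≤ n f))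

Σ-not : ∀ n (f : ℕ → Bool) → Σn n (λ a → ind (not (f a))) ≡ n ∸ Σn n (λ a → ind (f a))
Σ-not n f = begin
    fails                  ≡⟨ sym (m+n∸n≡m fails passes) ⟩
    fails + passes ∸ passes ≡⟨ cong (_∸ passes) total ⟩
    n ∸ passes             ∎
  where
  open ≡-Reasoning
  fails passes : ℕ
  fails  = Σn n (λ a → ind (not (f a)))
  passes = Σn n (λ a → ind (f a))
  total : fails + passes ≡ n
  total = begin
    fails + passes                               ≡⟨ sym (Σ-+ n _ _) ⟩
    Σn n (λ a → ind (not (f a)) + ind (f a))     ≡⟨ Σ-cong n (λ a _ → ind-not (f a)) ⟩
    Σn n (λ _ → 1)                               ≡⟨ trans (Σ-const n 1) (*-identityʳ n) ⟩
    n                                            ∎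

Σ-delta : ∀ n x → x < n → Σn n (λ a → ind (a ≡ᵇ x)) ≡ 1
Σ-delta (suc n) x x<1+n with m<1+n⇒m<n∨m≡n x<1+n
... | inj₁ x<n  = cong₂ _+_ (Σ-delta n x x<n) (cong ind (≡ᵇ-false (λ n≡x → <-irrefl (sym n≡x) x<n)))
... | inj₂ refl = cong₂ _+_ (Σ-zero n (λ a a<n → cong ind (≡ᵇ-false (λ a≡n → <-irrefl a≡n a<n))))
                            (cong ind (≡ᵇ-refl x))

countIn : (List ℕ → Bool) → List (List ℕ) → ℕ
countIn P L = length (filterᵇ P L)

countIn-∷ : ∀ P x L → countIn P (x ∷ L) ≡ ind (P x) + countIn P L
countIn-∷ P x L with P x
... | true  = refl
... | false = refl

countIn-++ : ∀ P (L M : List (List ℕ)) → countIn P (L ++ M) ≡ countIn P L + countIn P M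
countIn-++ P []      M = refl
countIn-++ P (x ∷ L) M = begin
    countIn P (x ∷ L ++ M)                   ≡⟨ countIn-∷ P x (L ++ M) ⟩
    ind (P x) + countIn P (L ++ M)           ≡⟨ cong (ind (P x) +_) (countIn-++ P L M) ⟩
    ind (P x) + (countIn P L + countIn P M)  ≡⟨ sym (+-assoc (ind (P x)) _ _) ⟩
    ind (P x) + countIn P L + countIn P M    ≡⟨ cong (_+ countIn P M) (sym (countIn-∷ P x L)) ⟩
    countIn P (x ∷ L) + countIn P M          ∎
  where open ≡-Reasoning

countIn-map : ∀ P (h : List ℕ → List ℕ) L → countIn P (map h L) ≡ countIn (λ xs → P (h xs)) L
countIn-map P h []      = refl
countIn-map P h (x ∷ L) = trans (countIn-∷ P (h x) (map h L))
  (trans (cong (ind (P (h x)) +_) (countIn-map P h L)) (sym (countIn-∷ (λ xs → P (h xs)) x L)))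

countIn-false : ∀ P L → (∀ xs → P xs ≡ false) → countIn P L ≡ 0
countIn-false P []      h = refl
countIn-false P (x ∷ L) h = trans (countIn-∷ P x L) (cong₂ _+_ (cong ind (h x)) (countIn-false P L h))

countIn-concatMap : ∀ P (g : ℕ → List (List ℕ)) n →
  countIn P (concatMap g (upTo n)) ≡ Σn n (λ a → countIn P (g a))
countIn-concatMap P g zero    = refl
countIn-concatMap P g (suc n) = begin
    countIn P (concatMap g (upTo (suc n)))              ≡⟨ cong (λ u → countIn P (concatMap g u)) (sym (upTo-∷ʳ n)) ⟩
    countIn P (concatMap g (upTo n ++ n ∷ []))          ≡⟨ cong (countIn P) (concatMap-++ g (upTo n) (n ∷ [])) ⟩
    countIn P (concatMap g (upTo n) ++ (g n ++ []))     ≡⟨ countIn-++ P (concatMap g (upTo n)) (g n ++ []) ⟩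
    countIn P (concatMap g (upTo n)) + countIn P (g n ++ [])
      ≡⟨ cong₂ _+_ (countIn-concatMap P g n) (cong (countIn P) (++-identityʳ (g n))) ⟩
    Σn n (λ a → countIn P (g a)) + countIn P (g n)      ∎
  where open ≡-Reasoning

countIn-split : ∀ (P Q : List ℕ → Bool) L →
  countIn (λ x → P x ∧ not (Q x)) L + countIn (λ x → P x ∧ Q x) L ≡ countIn P L
countIn-split P Q []      = refl
countIn-split P Q (x ∷ L) = begin
    countIn P¬Q (x ∷ L) + countIn PQ (x ∷ L)
      ≡⟨ cong₂ _+_ (countIn-∷ P¬Q x L) (countIn-∷ PQ x L) ⟩
    (ind (P¬Q x) + countIn P¬Q L) + (ind (PQ x) + countIn PQ L)
      ≡⟨ interchange (ind (P¬Q x)) (countIn P¬Q L) (ind (PQ x)) (countIn PQ L) ⟩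
    (ind (P¬Q x) + ind (PQ x)) + (countIn P¬Q L + countIn PQ L)
      ≡⟨ cong₂ _+_ (split (P x) (Q x)) (countIn-split P Q L) ⟩
    ind (P x) + countIn P L
      ≡⟨ sym (countIn-∷ P x L) ⟩
    countIn P (x ∷ L) ∎
  where
  open ≡-Reasoning
  P¬Q PQ : List ℕ → Bool
  P¬Q x = P x ∧ not (Q x)
  PQ  x = P x ∧ Q x
  split : ∀ p q → ind (p ∧ not q) + ind (p ∧ q) ≡ ind p
  split true  true  = refl
  split true  false = refl
  split false _     = refl

count : ℕ → ℕ → (List ℕ → Bool) → ℕ
count n m P = countIn P (seqs n m)

count-cons : ∀ n m P → count n (suc m) P ≡ Σn n (λ a → count n m (λ xs → P (a ∷ xs)))
count-cons n m P = trans (countIn-concatMap P (λ a → map (a ∷_) (seqs n m)) n)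
                         (Σ-cong n (λ a _ → countIn-map P (a ∷_) (seqs n m)))

count-false : ∀ n m P → (∀ xs → P xs ≡ false) → count n m P ≡ 0
count-false n m P = countIn-false P (seqs n m)

AllLt : ℕ → List ℕ → Bool
AllLt n xs = all (λ a → a <ᵇ n) xs

count-cong : ∀ n m {P Q : List ℕ → Bool} →
  (∀ xs → length xs ≡ m → AllLt n xs ≡ true → P xs ≡ Q xs) → count n m P ≡ count n m Q
count-cong n zero    {P} {Q} h = trans (countIn-∷ P [] [])
  (trans (cong (λ b → ind b + 0) (h [] refl refl)) (sym (countIn-∷ Q [] [])))
count-cong n (suc m) {P} {Q} h = trans (count-cons n m P) (trans (Σ-cong n (λ a a<n →
    count-cong n m (λ xs len al → h (a ∷ xs) (cong suc len) (trans (cong (_∧ AllLt n xs) (<ᵇ-true a<n)) al))))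
  (sym (count-cons n m Q)))

count-snoc : ∀ n m P → count n (suc m) P ≡ Σn n (λ c → count n m (λ xs → P (xs ∷ʳ c)))
count-snoc n zero    P = trans (count-cons n zero P)
  (Σ-cong n (λ c _ → count-cong n zero {λ xs → P (c ∷ xs)} {λ xs → P (xs ∷ʳ c)} (λ { [] _ _ → refl })))
count-snoc n (suc m) P = begin
    count n (suc (suc m)) P
      ≡⟨ count-cons n (suc m) P ⟩
    Σn n (λ a → count n (suc m) (λ xs → P (a ∷ xs)))
      ≡⟨ Σ-cong n (λ a _ → count-snoc n m (λ xs → P (a ∷ xs))) ⟩
    Σn n (λ a → Σn n (λ c → count n m (λ xs → P (a ∷ (xs ∷ʳ c)))))
      ≡⟨ Σ-swap n n _ ⟩
    Σn n (λ c → Σn n (λ a → count n m (λ xs → P (a ∷ (xs ∷ʳ c)))))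
      ≡⟨ Σ-cong n (λ c _ → sym (count-cons n m (λ ys → P (ys ∷ʳ c)))) ⟩
    Σn n (λ c → count n (suc m) (λ xs → P (xs ∷ʳ c))) ∎
  where open ≡-Reasoning

elem : ℕ → List ℕ → Bool
elem a S = any (λ b → a ≡ᵇ b) S

-- fresh S xs: the letters of xs are pairwise distinct and do not occur in S.
-- Permutations of [n] are exactly the fresh words (from []) of length n below n.
fresh : List ℕ → List ℕ → Bool
fresh S []       = true
fresh S (a ∷ xs) = not (elem a S) ∧ fresh (a ∷ S) xs

fresh-cong : ∀ {S S'} xs → (∀ a → elem a S ≡ elem a S') → fresh S xs ≡ fresh S' xs
fresh-cong []       h = refl
fresh-cong (a ∷ xs) h = cong₂ (λ u v → not u ∧ v) (h a) (fresh-cong xs (λ b → cong ((b ≡ᵇ a) ∨_) (h b)))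

fresh-snoc : ∀ S xs c → fresh S (xs ∷ʳ c) ≡ fresh S (c ∷ xs)
fresh-snoc S []       c = refl
fresh-snoc S (x ∷ xs) c = begin
    not (elem x S) ∧ fresh (x ∷ S) (xs ∷ʳ c)
      ≡⟨ cong (not (elem x S) ∧_) (fresh-snoc (x ∷ S) xs c) ⟩
    not (elem x S) ∧ (not ((c ≡ᵇ x) ∨ elem c S) ∧ fresh (c ∷ x ∷ S) xs)
      ≡⟨ cong (λ g → not (elem x S) ∧ (not ((c ≡ᵇ x) ∨ elem c S) ∧ g))
              (fresh-cong xs (λ a → swap∨ (a ≡ᵇ c) (a ≡ᵇ x) (elem a S))) ⟩
    not (elem x S) ∧ (not ((c ≡ᵇ x) ∨ elem c S) ∧ fresh (x ∷ c ∷ S) xs)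
      ≡⟨ swapTests (elem x S) (elem c S) _ _ _ (≡ᵇ-sym c x) ⟩
    not (elem c S) ∧ (not ((x ≡ᵇ c) ∨ elem x S) ∧ fresh (x ∷ c ∷ S) xs) ∎
  where
  open ≡-Reasoning
  swap∨ : ∀ p q r → (p ∨ (q ∨ r)) ≡ (q ∨ (p ∨ r))
  swap∨ true  true  r = refl
  swap∨ true  false r = refl
  swap∨ false q     r = refl
  swapTests : ∀ X C e e' G → e ≡ e' → (not X ∧ (not (e ∨ C) ∧ G)) ≡ (not C ∧ (not (e' ∨ X) ∧ G))
  swapTests true  true  e     .e     G refl = refl
  swapTests true  false true  .true  G refl = refl
  swapTests true  false false .false G refl = refl
  swapTests false true  true  .true  G refl = refl
  swapTests false true  false .false G refl = refl
  swapTests false false e     .e     G refl = refl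

disjoint : List ℕ → List ℕ → Bool
disjoint S xs = all (λ x → not (elem x S)) xs

disjoint-[] : ∀ xs → disjoint [] xs ≡ true
disjoint-[] []       = refl
disjoint-[] (x ∷ xs) = disjoint-[] xs

disjoint-∷ : ∀ a S xs → disjoint (a ∷ S) xs ≡ (not (elem a xs) ∧ disjoint S xs)
disjoint-∷ a S []       = refl
disjoint-∷ a S (y ∷ ys) = trans (cong (not ((y ≡ᵇ a) ∨ elem y S) ∧_) (disjoint-∷ a S ys))
    (exchange (y ≡ᵇ a) (a ≡ᵇ y) (elem y S) (elem a ys) (disjoint S ys) (≡ᵇ-sym y a))
  where
  exchange : ∀ e e' Y E R → e ≡ e' → (not (e ∨ Y) ∧ (not E ∧ R)) ≡ (not (e' ∨ E) ∧ (not Y ∧ R))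
  exchange true  .true  Y     E     R refl = refl
  exchange false .false true  true  R refl = refl
  exchange false .false true  false R refl = refl
  exchange false .false false true  R refl = refl
  exchange false .false false false R refl = refl

fresh≡disjoint∧distinct : ∀ S xs → fresh S xs ≡ (disjoint S xs ∧ distinct xs)
fresh≡disjoint∧distinct S []       = refl
fresh≡disjoint∧distinct S (a ∷ xs) =
  trans (cong (not (elem a S) ∧_) (trans (fresh≡disjoint∧distinct (a ∷ S) xs)
                                         (cong (_∧ distinct xs) (disjoint-∷ a S xs))))
        (regroup (elem a S) (elem a xs) (disjoint S xs) (distinct xs))
  where
  regroup : ∀ A E D Di → (not A ∧ ((not E ∧ D) ∧ Di)) ≡ ((not A ∧ D) ∧ (not E ∧ Di))
  regroup true  E     D     Di = refl
  regroup false true  true  Di = refl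
  regroup false true  false Di = refl
  regroup false false true  Di = refl
  regroup false false false Di = refl

distinct≡fresh : ∀ xs → distinct xs ≡ fresh [] xs
distinct≡fresh xs = sym (trans (fresh≡disjoint∧distinct [] xs) (cong (_∧ distinct xs) (disjoint-[] xs)))

-- S consists of |S| distinct letters below n (counted through the letters below n).
DistinctBelow : ℕ → List ℕ → Set
DistinctBelow n S = Σn n (λ a → ind (elem a S)) ≡ length S

Σ-insert : ∀ n a (E : ℕ → Bool) → a < n → E a ≡ false →
  Σn n (λ b → ind ((b ≡ᵇ a) ∨ E b)) ≡ suc (Σn n (λ b → ind (E b)))
Σ-insert n a E a<n Ea≡false =
  trans (Σ-cong n split) (trans (Σ-+ n _ _) (cong (_+ Σn n (λ b → ind (E b))) (Σ-delta n a a<n)))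
  where
  split : ∀ b → b < n → ind ((b ≡ᵇ a) ∨ E b) ≡ ind (b ≡ᵇ a) + ind (E b)
  split b _ with b ≡ᵇ a in e
  ... | true  = cong (λ t → 1 + ind t) (sym (trans (cong E (≡ᵇ-sound b a e)) Ea≡false))
  ... | false = refl

DistinctBelow-[] : ∀ n → DistinctBelow n []
DistinctBelow-[] n = Σ-zero n (λ _ _ → refl)

DistinctBelow-∷ : ∀ n a S → a < n → elem a S ≡ false → DistinctBelow n S → DistinctBelow n (a ∷ S)
DistinctBelow-∷ n a S a<n a∉S S-ok = trans (Σ-insert n a (λ b → elem b S) a<n a∉S) (cong suc S-ok)

avoiding : ∀ n S → DistinctBelow n S → Σn n (λ a → ind (not (elem a S))) ≡ n ∸ length S
avoiding n S S-ok = trans (Σ-not n (λ a → elem a S)) (cong (n ∸_) S-ok)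

-- If S uses |S| of the n letters, the words of length m = n - |S| that are fresh
-- from S are the arrangements of the remaining m letters: there are m! of them.
count-fresh : ∀ n m S → DistinctBelow n S → length S + m ≡ n → count n m (fresh S) ≡ m !
count-fresh n zero    S S-ok len = refl
count-fresh n (suc m) S S-ok len = begin
    count n (suc m) (fresh S)
      ≡⟨ count-cons n m (fresh S) ⟩
    Σn n (λ a → count n m (λ xs → not (elem a S) ∧ fresh (a ∷ S) xs))
      ≡⟨ Σ-cong n byFirstLetter ⟩
    Σn n (λ a → ind (not (elem a S)) * m !)
      ≡⟨ Σ-*r n _ (m !) ⟩
    Σn n (λ a → ind (not (elem a S))) * m !
      ≡⟨ cong (_* m !) (avoiding n S S-ok) ⟩
    (n ∸ length S) * m !
      ≡⟨ cong (λ k → (k ∸ length S) * m !) (sym len) ⟩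
    (length S + suc m ∸ length S) * m !
      ≡⟨ cong (_* m !) (m+n∸m≡n (length S) (suc m)) ⟩
    suc m * m ! ∎
  where
  open ≡-Reasoning
  byFirstLetter : ∀ a → a < n →
    count n m (λ xs → not (elem a S) ∧ fresh (a ∷ S) xs) ≡ ind (not (elem a S)) * m !
  byFirstLetter a a<n with elem a S in a∈S
  ... | true  = count-false n m _ (λ xs → refl)
  ... | false = trans (count-fresh n m (a ∷ S) (DistinctBelow-∷ n a S a<n a∈S S-ok)
                                   (trans (sym (+-suc (length S) m)) len))
                      (sym (+-identityʳ (m !)))

isPerm≡fresh : ∀ n xs → length xs ≡ n → AllLt n xs ≡ true → isPerm n xs ≡ fresh [] xs
isPerm≡fresh n xs len al = begin
    (length xs ≡ᵇ n) ∧ (AllLt n xs ∧ distinct xs) ≡⟨ cong (λ u → (u ≡ᵇ n) ∧ (AllLt n xs ∧ distinct xs)) len ⟩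
    (n ≡ᵇ n) ∧ (AllLt n xs ∧ distinct xs)         ≡⟨ cong₂ (λ u v → u ∧ (v ∧ distinct xs)) (≡ᵇ-refl n) al ⟩
    distinct xs                                   ≡⟨ distinct≡fresh xs ⟩
    fresh [] xs                                   ∎
  where open ≡-Reasoning

count-perms : ∀ n → count n n (isPerm n) ≡ n !
count-perms n = trans (count-cong n n (isPerm≡fresh n)) (count-fresh n n [] (DistinctBelow-[] n) refl)

subword : List ℕ → List ℕ → Bool
subword []      xs       = true
subword (x ∷ w) []       = false
subword (x ∷ w) (a ∷ xs) = if a ≡ᵇ x then subword w xs else subword (x ∷ w) xs

subword-elem : ∀ w xs a → subword w xs ≡ true → elem a w ≡ true → elem a xs ≡ true
subword-elem (x ∷ w) (b ∷ ys) a s a∈w with b ≡ᵇ x in b≟x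
... | false = trans (cong ((a ≡ᵇ b) ∨_) (subword-elem (x ∷ w) ys a s a∈w)) (∨-zeroʳ _)
... | true with a ≡ᵇ x in a≟x
...   | true  = cong (_∨ elem a ys) (≡ᵇ-true (trans (≡ᵇ-sound a x a≟x) (sym (≡ᵇ-sound b x b≟x))))
...   | false = trans (cong ((a ≡ᵇ b) ∨_) (subword-elem w ys a s a∈w)) (∨-zeroʳ _)

fresh-elem : ∀ S xs a → fresh S xs ≡ true → elem a S ≡ true → elem a xs ≡ false
fresh-elem S []       a f a∈S = refl
fresh-elem S (b ∷ ys) a f a∈S with a ≡ᵇ b in a≟b
... | true  = ⊥-elim (false≢true (trans (sym (cong not b∈S)) (∧-conicalˡ _ _ f)))
  where
  b∈S : elem b S ≡ true
  b∈S = trans (cong (λ u → elem u S) (sym (≡ᵇ-sound a b a≟b))) a∈S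
... | false = fresh-elem (b ∷ S) ys a (∧-conicalʳ _ _ f) (trans (cong ((a ≡ᵇ b) ∨_) a∈S) (∨-zeroʳ (a ≡ᵇ b)))

fresh-subword-clash : ∀ S w xs a → elem a S ≡ true → elem a w ≡ true → (fresh S xs ∧ subword w xs) ≡ false
fresh-subword-clash S w xs a a∈S a∈w with fresh S xs in f | subword w xs in s
... | true  | true  = ⊥-elim (false≢true (trans (sym (fresh-elem S xs a f a∈S)) (subword-elem w xs a s a∈w)))
... | true  | false = refl
... | false | _     = refl

JointlyDistinctBelow : ℕ → List ℕ → List ℕ → Set
JointlyDistinctBelow n S w = Σn n (λ a → ind (elem a S ∨ elem a w)) ≡ length S + length w

leftover-letters : ∀ n m S w → JointlyDistinctBelow n S w → length S + m ≡ n →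
  length w ≤ m × Σn n (λ a → ind (not (elem a S ∨ elem a w))) ≡ m ∸ length w
leftover-letters n m S w jd len = +-cancelˡ-≤ (length S) (length w) m used≤ , leftover
  where
  open ≡-Reasoning
  used≤ : length S + length w ≤ length S + m
  used≤ = subst (length S + length w ≤_) (sym len) (subst (_≤ n) jd (Σ-ind≤ n (λ a → elem a S ∨ elem a w)))
  leftover : Σn n (λ a → ind (not (elem a S ∨ elem a w))) ≡ m ∸ length w
  leftover = begin
    Σn n (λ a → ind (not (elem a S ∨ elem a w)))   ≡⟨ trans (Σ-not n _) (cong (n ∸_) jd) ⟩
    n ∸ (length S + length w)                        ≡⟨ cong (_∸ (length S + length w)) (sym len) ⟩
    length S + m ∸ (length S + length w)             ≡⟨ [m+n]∸[m+o]≡n∸o (length S) m (length w) ⟩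
    m ∸ length w                                     ∎

-- The arithmetic of a first-letter decomposition in which one letter contributes
-- (t+1)·m! and each of m - t further letters contributes m!.
firstLetter-total : ∀ n m t (D E : ℕ → Bool) → Σn n (λ a → ind (D a)) ≡ 1 →
  Σn n (λ a → ind (not (E a))) ≡ m ∸ t → t ≤ m →
  Σn n (λ a → ind (D a) * (suc t * m !) + ind (not (E a)) * m !) ≡ suc m * m !
firstLetter-total n m t D E one rest t≤m = begin
    Σn n (λ a → ind (D a) * K + ind (not (E a)) * m !)
      ≡⟨ Σ-+ n _ _ ⟩
    Σn n (λ a → ind (D a) * K) + Σn n (λ a → ind (not (E a)) * m !)
      ≡⟨ cong₂ _+_ (Σ-*r n _ K) (Σ-*r n _ (m !)) ⟩
    Σn n (λ a → ind (D a)) * K + Σn n (λ a → ind (not (E a))) * m !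
      ≡⟨ cong₂ (λ u v → u * K + v * m !) one rest ⟩
    1 * K + (m ∸ t) * m !
      ≡⟨ cong (_+ (m ∸ t) * m !) (*-identityˡ K) ⟩
    suc t * m ! + (m ∸ t) * m !
      ≡⟨ sym (*-distribʳ-+ (m !) (suc t) (m ∸ t)) ⟩
    (suc t + (m ∸ t)) * m !
      ≡⟨ cong (λ k → suc k * m !) (m+[n∸m]≡n t≤m) ⟩
    suc m * m ! ∎
  where
  open ≡-Reasoning
  K : ℕ
  K = suc t * m !

-- Induction on m by the first letter a: a ∈ S gives nothing; a = head of w leaves
-- the tail of w to be found; a elsewhere in w makes w impossible; any other a
-- leaves w to be found.
count-fresh-subword : ∀ n m S w → JointlyDistinctBelow n S w → disjoint S w ≡ true →
  distinct w ≡ true → AllLt n w ≡ true → length S + m ≡ n →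
  length w ! * count n m (λ xs → fresh S xs ∧ subword w xs) ≡ m !
count-fresh-subword n m S [] jd _ _ _ len = trans (+-identityʳ _)
  (trans (count-cong n m (λ xs _ _ → ∧-identityʳ (fresh S xs)))
         (count-fresh n m S S-ok len))
  where
  S-ok : DistinctBelow n S
  S-ok = trans (Σ-cong n (λ a _ → cong ind (sym (∨-identityʳ (elem a S))))) (trans jd (+-identityʳ _))
count-fresh-subword n zero S (x ∷ w') jd _ _ _ len with proj₁ (leftover-letters n zero S (x ∷ w') jd len)
... | ()
count-fresh-subword n (suc m) S (x ∷ w') jd dj dw bw len = begin
    suc t ! * count n (suc m) P                  ≡⟨ cong (suc t ! *_) (count-cons n m P) ⟩
    suc t ! * Σn n startingWith                  ≡⟨ sym (Σ-*l n startingWith (suc t !)) ⟩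
    Σn n (λ a → suc t ! * startingWith a)        ≡⟨ Σ-cong n byFirstLetter ⟩
    Σn n (λ a → ind (a ≡ᵇ x) * (suc t * m !) + ind (not (E a)) * m !)
      ≡⟨ firstLetter-total n m t (_≡ᵇ x) E (Σ-delta n x x<n) (proj₂ leftover) (s≤s⁻¹ (proj₁ leftover)) ⟩
    suc m * m ! ∎
  where
  open ≡-Reasoning
  t : ℕ
  t = length w'
  P : List ℕ → Bool
  P xs = fresh S xs ∧ subword (x ∷ w') xs
  startingWith : ℕ → ℕ
  startingWith a = count n m (λ xs → P (a ∷ xs))
  E : ℕ → Bool
  E a = elem a S ∨ elem a (x ∷ w')
  x<n : x < n
  x<n = <ᵇ-sound x n (∧-conicalˡ _ _ bw)
  x∉S : elem x S ≡ false
  x∉S = proj₁ (not∧-elim _ _ dj)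
  x∉w' : elem x w' ≡ false
  x∉w' = proj₁ (not∧-elim _ _ dw)
  leftover : suc t ≤ suc m × Σn n (λ a → ind (not (E a))) ≡ m ∸ t
  leftover = leftover-letters n (suc m) S (x ∷ w') jd len
  afterHead : t ! * count n m (λ xs → fresh (x ∷ S) xs ∧ subword w' xs) ≡ m !
  afterHead = count-fresh-subword n m (x ∷ S) w'
    (trans (Σ-cong n (λ b _ → cong ind (rot (b ≡ᵇ x) (elem b S) (elem b w')))) (trans jd (+-suc (length S) t)))
    (trans (disjoint-∷ x S w') (cong₂ _∧_ (cong not x∉w') (proj₂ (not∧-elim _ _ dj))))
    (proj₂ (not∧-elim _ _ dw)) (∧-conicalʳ _ _ bw) (trans (sym (+-suc (length S) m)) len)
    where
    rot : ∀ p q r → ((p ∨ q) ∨ r) ≡ (q ∨ (p ∨ r))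
    rot p q r = trans (cong (_∨ r) (∨-comm p q)) (∨-assoc q p r)
  byFirstLetter : ∀ a → a < n → suc t ! * startingWith a ≡ ind (a ≡ᵇ x) * (suc t * m !) + ind (not (E a)) * m !
  byFirstLetter a a<n with elem a S in a∈S | a ≡ᵇ x in a≟x | elem a w' in a∈w'
  -- a ∈ S: no fresh word starts with a (and a ≠ x since x ∉ S)
  ... | true  | true  | _ = ⊥-elim (false≢true (trans (sym x∉S)
                              (trans (cong (λ u → elem u S) (sym (≡ᵇ-sound a x a≟x))) a∈S)))
  ... | true  | false | _ = trans (cong (suc t ! *_) (count-false n m _ (λ xs → refl))) (*-zeroʳ (suc t !))
  -- a = x: the tail w' remains to be found
  ... | false | true  | _ = begin
        suc t ! * count n m (λ xs → fresh (a ∷ S) xs ∧ subword w' xs)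
          ≡⟨ *-assoc (suc t) (t !) _ ⟩
        suc t * (t ! * count n m (λ xs → fresh (a ∷ S) xs ∧ subword w' xs))
          ≡⟨ cong (λ u → suc t * (t ! * count n m (λ xs → fresh (u ∷ S) xs ∧ subword w' xs))) (≡ᵇ-sound a x a≟x) ⟩
        suc t * (t ! * count n m (λ xs → fresh (x ∷ S) xs ∧ subword w' xs))
          ≡⟨ cong (suc t *_) afterHead ⟩
        suc t * m !
          ≡⟨ sym (trans (+-identityʳ _) (+-identityʳ _)) ⟩
        (suc t * m ! + 0) + 0 ∎
  -- a in w' but not its head: a cannot occur again, so w is not found
  ... | false | false | true  = trans (cong (suc t ! *_) (count-false n m _ (λ xs →
          fresh-subword-clash (a ∷ S) (x ∷ w') xs a (cong (_∨ elem a S) (≡ᵇ-refl a)) (cong₂ _∨_ a≟x a∈w'))))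
          (*-zeroʳ (suc t !))
  -- a outside S ∪ w: all of w remains to be found
  ... | false | false | false = trans stillToFind (sym (+-identityʳ (m !)))
    where
    stillToFind : suc t ! * count n m (λ xs → fresh (a ∷ S) xs ∧ subword (x ∷ w') xs) ≡ m !
    stillToFind = count-fresh-subword n m (a ∷ S) (x ∷ w')
      (trans (Σ-cong n (λ b _ → cong ind (∨-assoc (b ≡ᵇ a) (elem b S) (elem b (x ∷ w')))))
             (trans (Σ-insert n a E a<n (cong₂ _∨_ a∈S (cong₂ _∨_ a≟x a∈w'))) (cong suc jd)))
      (trans (disjoint-∷ a S (x ∷ w')) (cong₂ _∧_ (cong not (cong₂ _∨_ a≟x a∈w')) dj))
      dw bw (trans (sym (+-suc (length S) m)) len)

subword-cons : ∀ w π a → subword w π ≡ true → subword w (a ∷ π) ≡ true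
subword-tail : ∀ x w π → subword (x ∷ w) π ≡ true → subword w π ≡ true
subword-cons []      π a s = refl
subword-cons (x ∷ w) π a s with a ≡ᵇ x
... | true  = subword-tail x w π s
... | false = s
subword-tail x w (b ∷ π) s with b ≡ᵇ x
... | true  = subword-cons w π b s
... | false = subword-cons w π b (subword-tail x w π s)

increasing-head : ∀ i rest → strictlyIncreasing (i ∷ rest) ≡ true → all (λ r → i <ᵇ r) rest ≡ true
increasing-head i []       h = refl
increasing-head i (r ∷ rs) h = ∧-intro (∧-conicalˡ _ _ h) (above rs (increasing-head r rs (∧-conicalʳ _ _ h)))
  where
  i<r : i < r
  i<r = <ᵇ-sound i r (∧-conicalˡ _ _ h)
  above : ∀ qs → all (λ q → r <ᵇ q) qs ≡ true → all (λ q → i <ᵇ q) qs ≡ true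
  above []       _  = refl
  above (q ∷ qs) hq = ∧-intro (<ᵇ-true (<-trans i<r (<ᵇ-sound r q (∧-conicalˡ _ _ hq)))) (above qs (∧-conicalʳ _ _ hq))

all-above⇒suc : ∀ i rest → all (λ r → i <ᵇ r) rest ≡ true → Σ[ rest' ∈ List ℕ ] rest ≡ map suc rest'
all-above⇒suc i []           h = [] , refl
all-above⇒suc i (suc r ∷ rs) h with all-above⇒suc i rs (∧-conicalʳ (i <ᵇ suc r) _ h)
... | rs' , refl = r ∷ rs' , refl

increasing-suc : ∀ xs → strictlyIncreasing (map suc xs) ≡ strictlyIncreasing xs
increasing-suc []           = refl
increasing-suc (x ∷ [])     = refl
increasing-suc (x ∷ y ∷ xs) = cong ((x <ᵇ y) ∧_) (increasing-suc (y ∷ xs))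

increasing-0suc : ∀ xs → strictlyIncreasing (0 ∷ map suc xs) ≡ strictlyIncreasing xs
increasing-0suc []       = refl
increasing-0suc (x ∷ xs) = increasing-suc (x ∷ xs)

AllLt-suc : ∀ L xs → AllLt (suc L) (map suc xs) ≡ AllLt L xs
AllLt-suc L []       = refl
AllLt-suc L (x ∷ xs) = cong ((x <ᵇ L) ∧_) (AllLt-suc L xs)

at-suc : ∀ a π xs → map (at 0 (a ∷ π)) (map suc xs) ≡ map (at 0 π) xs
at-suc a π []       = refl
at-suc a π (x ∷ xs) = cong (at 0 π x ∷_) (at-suc a π xs)

subword-complete : ∀ π idx → strictlyIncreasing idx ≡ true → AllLt (length π) idx ≡ true →
  subword (map (at 0 π) idx) π ≡ true
subword-complete π       []          _  _  = refl
subword-complete (a ∷ π) (zero ∷ rest) si al with all-above⇒suc 0 rest (increasing-head 0 rest si)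
... | rest' , refl = subst (λ b → (if b then subword w π else subword (a ∷ w) π) ≡ true) (sym (≡ᵇ-refl a))
      (subst (λ w → subword w π ≡ true) (sym (at-suc a π rest'))
        (subword-complete π rest' (trans (sym (increasing-0suc rest')) si)
                                  (trans (sym (AllLt-suc (length π) rest')) (∧-conicalʳ _ _ al))))
  where
  w : List ℕ
  w = map (at 0 (a ∷ π)) (map suc rest')
subword-complete (a ∷ π) (suc i ∷ rest) si al with all-above⇒suc (suc i) rest (increasing-head (suc i) rest si)
... | rest' , refl = subword-cons _ π a (subst (λ w → subword w π ≡ true) (sym (at-suc a π (i ∷ rest')))
      (subword-complete π (i ∷ rest') (trans (sym (increasing-suc (i ∷ rest'))) si)
                                      (trans (sym (AllLt-suc (length π) (i ∷ rest'))) al)))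

subword-sound : ∀ w π → subword w π ≡ true →
  Σ[ idx ∈ List ℕ ] (strictlyIncreasing idx ≡ true × AllLt (length π) idx ≡ true × map (at 0 π) idx ≡ w)
subword-sound []      π       s = [] , refl , refl , refl
subword-sound (x ∷ w) (a ∷ π) s with a ≡ᵇ x in a≟x
... | true with subword-sound w π s
...   | idx , si , al , eq = 0 ∷ map suc idx , trans (increasing-0suc idx) si ,
          trans (AllLt-suc (length π) idx) al , cong₂ _∷_ (≡ᵇ-sound a x a≟x) (trans (at-suc a π idx) eq)
subword-sound (x ∷ w) (a ∷ π) s | false with subword-sound (x ∷ w) π s
...   | idx , si , al , eq = map suc idx , trans (increasing-suc idx) si ,
          trans (AllLt-suc (length π) idx) al , trans (at-suc a π idx) eq

data Perm3 : Set where
  p012 p021 p102 p120 p201 p210 : Perm3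

data I3 : Set where
  i0 i1 i2 : I3

index : I3 → ℕ
index i0 = 0
index i1 = 1
index i2 = 2

slot : Perm3 → I3 → I3
slot p012 i0 = i0
slot p012 i1 = i1
slot p012 i2 = i2
slot p021 i0 = i0
slot p021 i1 = i2
slot p021 i2 = i1
slot p102 i0 = i1
slot p102 i1 = i0
slot p102 i2 = i2
slot p120 i0 = i1
slot p120 i1 = i2
slot p120 i2 = i0
slot p201 i0 = i2
slot p201 i1 = i0
slot p201 i2 = i1
slot p210 i0 = i2
slot p210 i1 = i1
slot p210 i2 = i0

inverse : Perm3 → Perm3
inverse p120 = p201
inverse p201 = p120
inverse ρ    = ρ

oneLine : Perm3 → Vec (Fin 3) 3
oneLine ρ = fin (slot ρ i0) V.∷ fin (slot ρ i1) V.∷ fin (slot ρ i2) V.∷ V.[]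
  where
  fin : I3 → Fin 3
  fin i0 = F.zero
  fin i1 = F.suc F.zero
  fin i2 = F.suc (F.suc F.zero)

Triple : Set
Triple = ℕ × ℕ × ℕ

pick : I3 → Triple → ℕ
pick i0 (a , b , c) = a
pick i1 (a , b , c) = b
pick i2 (a , b , c) = c

list3 : Triple → List ℕ
list3 (a , b , c) = a ∷ b ∷ c ∷ []

list3-injective : ∀ {t t' : Triple} → list3 t ≡ list3 t' → t ≡ t'
list3-injective {a , b , c} refl = refl

Increasing : Triple → Set
Increasing (a , b , c) = a < b × b < c

increasing? : Triple → Bool
increasing? (a , b , c) = (a <ᵇ b) ∧ (b <ᵇ c)

increasing?-sound : ∀ u → increasing? u ≡ true → Increasing u
increasing?-sound (a , b , c) h = <ᵇ-sound a b (∧-conicalˡ _ _ h) , <ᵇ-sound b c (∧-conicalʳ _ _ h)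

increasing?-complete : ∀ u → Increasing u → increasing? u ≡ true
increasing?-complete (a , b , c) (a<b , b<c) = ∧-intro (<ᵇ-true a<b) (<ᵇ-true b<c)

-- arrange ρ u puts the entries of u in relative order ρ (position i gets u_ρ(i));
-- arrange (inverse ρ) undoes it, so it sorts a triple of relative order ρ.
arrange : Perm3 → Triple → Triple
arrange ρ u = pick (slot ρ i0) u , pick (slot ρ i1) u , pick (slot ρ i2) u

pick-arrange : ∀ ρ u i → pick i (arrange ρ u) ≡ pick (slot ρ i) u
pick-arrange ρ u i0 = refl
pick-arrange ρ u i1 = refl
pick-arrange ρ u i2 = refl

arrange-inverse : ∀ ρ t → arrange ρ (arrange (inverse ρ) t) ≡ t
arrange-inverse p012 (a , b , c) = refl
arrange-inverse p021 (a , b , c) = refl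
arrange-inverse p102 (a , b , c) = refl
arrange-inverse p120 (a , b , c) = refl
arrange-inverse p201 (a , b , c) = refl
arrange-inverse p210 (a , b , c) = refl

oneLine-list : ∀ ρ → map toℕ (vtoList (oneLine ρ)) ≡ list3 (arrange ρ (0 , 1 , 2))
oneLine-list p012 = refl
oneLine-list p021 = refl
oneLine-list p102 = refl
oneLine-list p120 = refl
oneLine-list p201 = refl
oneLine-list p210 = refl

increasing-compare : ∀ u → Increasing u → ∀ i j → (pick i u <ᵇ pick j u) ≡ (index i <ᵇ index j)
increasing-compare (a , b , c) (a<b , b<c) = cmp
  where
  irrefl : ∀ x → (x <ᵇ x) ≡ false
  irrefl x = <ᵇ-false (n≮n x)
  cmp : ∀ i j → (pick i (a , b , c) <ᵇ pick j (a , b , c)) ≡ (index i <ᵇ index j)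
  cmp i0 i0 = irrefl a
  cmp i0 i1 = <ᵇ-true a<b
  cmp i0 i2 = <ᵇ-true (<-trans a<b b<c)
  cmp i1 i0 = <ᵇ-false (<⇒≯ a<b)
  cmp i1 i1 = irrefl b
  cmp i1 i2 = <ᵇ-true b<c
  cmp i2 i0 = <ᵇ-false (<⇒≯ (<-trans a<b b<c))
  cmp i2 i1 = <ᵇ-false (<⇒≯ b<c)
  cmp i2 i2 = irrefl c

pick-012 : ∀ j → pick j (0 , 1 , 2) ≡ index j
pick-012 i0 = refl
pick-012 i1 = refl
pick-012 i2 = refl

SameOrder : Triple → Triple → Set
SameOrder t s = ∀ i j → (pick i t <ᵇ pick j t) ≡ (pick i s <ᵇ pick j s)

arrange-sameOrder : ∀ ρ u → Increasing u → SameOrder (arrange ρ u) (arrange ρ (0 , 1 , 2))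
arrange-sameOrder ρ u inc i j = begin
    (pick i (arrange ρ u) <ᵇ pick j (arrange ρ u))   ≡⟨ cong₂ _<ᵇ_ (pick-arrange ρ u i) (pick-arrange ρ u j) ⟩
    (pick (slot ρ i) u <ᵇ pick (slot ρ j) u)         ≡⟨ increasing-compare u inc (slot ρ i) (slot ρ j) ⟩
    (index (slot ρ i) <ᵇ index (slot ρ j))           ≡⟨ sym (cong₂ _<ᵇ_ (pick-012 (slot ρ i)) (pick-012 (slot ρ j))) ⟩
    (pick (slot ρ i) (0 , 1 , 2) <ᵇ pick (slot ρ j) (0 , 1 , 2))
      ≡⟨ sym (cong₂ _<ᵇ_ (pick-arrange ρ (0 , 1 , 2) i) (pick-arrange ρ (0 , 1 , 2) j)) ⟩
    (pick i (arrange ρ (0 , 1 , 2)) <ᵇ pick j (arrange ρ (0 , 1 , 2))) ∎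
  where open ≡-Reasoning

-- The order-isomorphism test of occurrenceAt (Defs), written out for length 3:
-- it is the conjunction of `agree` over all nine pairs of positions.
agree : Bool → Bool → Bool
agree b b' = (b ∧ b') ∨ (not b ∧ not b')

agree-sound : ∀ b b' → agree b b' ≡ true → b ≡ b'
agree-sound true  true  _ = refl
agree-sound false false _ = refl

agree-refl : ∀ b → agree b b ≡ true
agree-refl true  = refl
agree-refl false = refl

comparisons : List ℕ → List ℕ → List Bool
comparisons sig vals = concatMap (λ a → map (λ b →
      ((at 0 vals a <ᵇ at 0 vals b) ∧ (at 0 sig a <ᵇ at 0 sig b)) ∨
      (not (at 0 vals a <ᵇ at 0 vals b) ∧ not (at 0 sig a <ᵇ at 0 sig b))) (upTo 3)) (upTo 3)

orderIso3 : List ℕ → List ℕ → Bool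
orderIso3 sig vals = and (comparisons sig vals)

and-at : ∀ bs k → and bs ≡ true → at true bs k ≡ true
and-at []       k       h = refl
and-at (b ∷ bs) zero    h = ∧-conicalˡ _ _ h
and-at (b ∷ bs) (suc k) h = and-at bs k (∧-conicalʳ _ _ h)

orderIso3-sound : ∀ t s → orderIso3 (list3 s) (list3 t) ≡ true → SameOrder t s
orderIso3-sound t@(x , y , z) s@(s0 , s1 , s2) h i j = agree-sound _ _ (entry i j)
  where
  entry : ∀ i j → agree (pick i t <ᵇ pick j t) (pick i s <ᵇ pick j s) ≡ true
  entry i0 i0 = and-at (comparisons (list3 s) (list3 t)) 0 h
  entry i0 i1 = and-at (comparisons (list3 s) (list3 t)) 1 h
  entry i0 i2 = and-at (comparisons (list3 s) (list3 t)) 2 h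
  entry i1 i0 = and-at (comparisons (list3 s) (list3 t)) 3 h
  entry i1 i1 = and-at (comparisons (list3 s) (list3 t)) 4 h
  entry i1 i2 = and-at (comparisons (list3 s) (list3 t)) 5 h
  entry i2 i0 = and-at (comparisons (list3 s) (list3 t)) 6 h
  entry i2 i1 = and-at (comparisons (list3 s) (list3 t)) 7 h
  entry i2 i2 = and-at (comparisons (list3 s) (list3 t)) 8 h

orderIso3-complete : ∀ t s → SameOrder t s → orderIso3 (list3 s) (list3 t) ≡ true
orderIso3-complete (x , y , z) (s0 , s1 , s2) same =
  ∧-intro (entry i0 i0) (∧-intro (entry i0 i1) (∧-intro (entry i0 i2) (
  ∧-intro (entry i1 i0) (∧-intro (entry i1 i1) (∧-intro (entry i1 i2) (
  ∧-intro (entry i2 i0) (∧-intro (entry i2 i1) (∧-intro (entry i2 i2) refl))))))))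
  where
  entry : ∀ i j → agree (pick i (x , y , z) <ᵇ pick j (x , y , z)) (pick i (s0 , s1 , s2) <ᵇ pick j (s0 , s1 , s2)) ≡ true
  entry i j rewrite same i j = agree-refl (pick i (s0 , s1 , s2) <ᵇ pick j (s0 , s1 , s2))

orderIso3-arrange : ∀ ρ u → Increasing u → orderIso3 (map toℕ (vtoList (oneLine ρ))) (list3 (arrange ρ u)) ≡ true
orderIso3-arrange ρ u inc = subst (λ s → orderIso3 s (list3 (arrange ρ u)) ≡ true) (sym (oneLine-list ρ))
  (orderIso3-complete (arrange ρ u) (arrange ρ (0 , 1 , 2)) (arrange-sameOrder ρ u inc))

orderIso3-sorts : ∀ ρ t → orderIso3 (map toℕ (vtoList (oneLine ρ))) (list3 t) ≡ true → Increasing (arrange (inverse ρ) t)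
orderIso3-sorts ρ t h = sorted ρ (orderIso3-sound t (arrange ρ (0 , 1 , 2))
                                    (subst (λ s → orderIso3 s (list3 t) ≡ true) (oneLine-list ρ) h))
  where
  lt : ∀ ρ i j → SameOrder t (arrange ρ (0 , 1 , 2)) → (pick i (arrange ρ (0 , 1 , 2)) <ᵇ pick j (arrange ρ (0 , 1 , 2))) ≡ true →
       pick i t < pick j t
  lt ρ i j same e = <ᵇ-sound _ _ (trans (same i j) e)
  sorted : ∀ ρ → SameOrder t (arrange ρ (0 , 1 , 2)) → Increasing (arrange (inverse ρ) t)
  sorted p012 same = lt p012 i0 i1 same refl , lt p012 i1 i2 same refl
  sorted p021 same = lt p021 i0 i2 same refl , lt p021 i2 i1 same refl
  sorted p102 same = lt p102 i1 i0 same refl , lt p102 i0 i2 same refl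
  sorted p120 same = lt p120 i2 i0 same refl , lt p120 i0 i1 same refl
  sorted p201 same = lt p201 i1 i2 same refl , lt p201 i2 i0 same refl
  sorted p210 same = lt p210 i2 i1 same refl , lt p210 i1 i0 same refl

orderIso3≡sorted : ∀ ρ t → orderIso3 (map toℕ (vtoList (oneLine ρ))) (list3 t) ≡ increasing? (arrange (inverse ρ) t)
orderIso3≡sorted ρ t = bool-ext
  (λ h → increasing?-complete _ (orderIso3-sorts ρ t h))
  (λ h → subst (λ w → orderIso3 (map toℕ (vtoList (oneLine ρ))) (list3 w) ≡ true) (arrange-inverse ρ t)
                (orderIso3-arrange ρ _ (increasing?-sound _ h)))

sort-arrange : ∀ ρ u → Increasing u → sort (list3 (arrange ρ u)) ≡ list3 u
sort-arrange ρ (a , b , c) (a<b , b<c) = sorted ρ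
  where
  a<c : a < c
  a<c = <-trans a<b b<c
  keep : ∀ x y ys → x < y → insert x (y ∷ ys) ≡ x ∷ y ∷ ys
  keep x y ys x<y rewrite T⇒≡true (≤⇒≤ᵇ (<⇒≤ x<y)) = refl
  pass : ∀ x y ys → y < x → insert x (y ∷ ys) ≡ y ∷ insert x ys
  pass x y ys y<x with x ≤ᵇ y in x≤ᵇy
  ... | false = refl
  ... | true  = contradiction (≤ᵇ⇒≤ x y (≡true⇒T x≤ᵇy)) (<⇒≱ y<x)
  sorted : ∀ ρ → sort (list3 (arrange ρ (a , b , c))) ≡ a ∷ b ∷ c ∷ []
  sorted p012 = trans (cong (insert a) (keep b c [] b<c)) (keep a b (c ∷ []) a<b)
  sorted p021 = trans (cong (insert a) (pass c b [] b<c)) (keep a b (c ∷ []) a<b)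
  sorted p102 = trans (cong (insert b) (keep a c [] a<c)) (trans (pass b a (c ∷ []) a<b) (cong (a ∷_) (keep b c [] b<c)))
  sorted p120 = trans (cong (insert b) (pass c a [] a<c)) (trans (pass b a (c ∷ []) a<b) (cong (a ∷_) (keep b c [] b<c)))
  sorted p201 = trans (cong (insert c) (keep a b [] a<b)) (trans (pass c a (b ∷ []) a<c) (cong (a ∷_) (pass c b [] b<c)))
  sorted p210 = trans (cong (insert c) (pass b a [] a<b)) (trans (pass c a (b ∷ []) a<c) (cong (a ∷_) (pass c b [] b<c)))

data Shape : Set where
  sh012 sh013 sh023 sh123 : Shape

shapeSet : Shape → Subset 4
shapeSet sh012 = sub4 true  true  true  false
shapeSet sh013 = sub4 true  true  false true
shapeSet sh023 = sub4 true  false true  true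
shapeSet sh123 = sub4 false true  true  true

-- In [m+3], the adjacency constraints of a shape, imposed on the positions or on
-- the values of an occurrence, leave exactly one triple (0-based): forced sh m.
forced : Shape → ℕ → Triple
forced sh012 m = 0 , 1 , 2
forced sh013 m = 0 , 1 , suc (suc m)
forced sh023 m = 0 , suc m , suc (suc m)
forced sh123 m = m , suc m , suc (suc m)

forced-increasing : ∀ sh m → Increasing (forced sh m)
forced-increasing sh012 m = s≤s z≤n , s≤s (s≤s z≤n)
forced-increasing sh013 m = s≤s z≤n , s≤s (s≤s z≤n)
forced-increasing sh023 m = s≤s z≤n , n<1+n (suc m)
forced-increasing sh123 m = n<1+n m , n<1+n (suc m)

Below : ℕ → Triple → Set
Below n t = ∀ i → pick i t < n

forced-last : ∀ sh m → pick i2 (forced sh m) < 3 + m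
forced-last sh012 m = s≤s (s≤s (s≤s z≤n))
forced-last sh013 m = n<1+n (suc (suc m))
forced-last sh023 m = n<1+n (suc (suc m))
forced-last sh123 m = n<1+n (suc (suc m))

forced-below : ∀ sh m → Below (3 + m) (forced sh m)
forced-below sh m i2 = forced-last sh m
forced-below sh m i1 = <-trans (proj₂ (forced-increasing sh m)) (forced-last sh m)
forced-below sh m i0 = <-trans (proj₁ (forced-increasing sh m)) (forced-below sh m i1)

-- The adjacency tests of occurrenceAt (Defs) for k = 3: on the chosen positions
-- idx, and on the sorted chosen values.
adjacentPositions : ℕ → Subset 4 → List ℕ → Bool
adjacentPositions n Xs idx = all (λ x → not (at false (vtoList Xs) x) ∨ (I (suc x) ≡ᵇ suc (I x))) (upTo 4)
  where
  I : ℕ → ℕ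
  I zero    = 0
  I (suc x) = if x <ᵇ 3 then suc (at 0 idx x) else suc n

adjacentValues : ℕ → Subset 4 → List ℕ → Bool
adjacentValues n Ys sorted = all (λ y → not (at false (vtoList Ys) y) ∨ (J (suc y) ≡ᵇ suc (J y))) (upTo 4)
  where
  J : ℕ → ℕ
  J zero    = 0
  J (suc y) = if y <ᵇ 3 then suc (at 0 sorted y) else suc n

adjacency : ℕ → Shape → Triple → Bool
adjacency n sh012 (a , b , c) = (a ≡ᵇ 0) ∧ ((b ≡ᵇ suc a) ∧ ((c ≡ᵇ suc b) ∧ true))
adjacency n sh013 (a , b , c) = (a ≡ᵇ 0) ∧ ((b ≡ᵇ suc a) ∧ ((n ≡ᵇ suc c) ∧ true))
adjacency n sh023 (a , b , c) = (a ≡ᵇ 0) ∧ ((c ≡ᵇ suc b) ∧ ((n ≡ᵇ suc c) ∧ true))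
adjacency n sh123 (a , b , c) = (b ≡ᵇ suc a) ∧ ((c ≡ᵇ suc b) ∧ ((n ≡ᵇ suc c) ∧ true))

adjacentPositions≡adjacency : ∀ n sh t → adjacentPositions n (shapeSet sh) (list3 t) ≡ adjacency n sh t
adjacentPositions≡adjacency n sh012 (a , b , c) = refl
adjacentPositions≡adjacency n sh013 (a , b , c) = refl
adjacentPositions≡adjacency n sh023 (a , b , c) = refl
adjacentPositions≡adjacency n sh123 (a , b , c) = refl

adjacentValues≡adjacency : ∀ n sh t → adjacentValues n (shapeSet sh) (list3 t) ≡ adjacency n sh t
adjacentValues≡adjacency n sh012 (a , b , c) = refl
adjacentValues≡adjacency n sh013 (a , b , c) = refl
adjacentValues≡adjacency n sh023 (a , b , c) = refl
adjacentValues≡adjacency n sh123 (a , b , c) = refl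

conjuncts3 : ∀ p q r → (p ∧ (q ∧ (r ∧ true))) ≡ true → p ≡ true × q ≡ true × r ≡ true
conjuncts3 true  true  true  _ = refl , refl , refl
conjuncts3 false _     _     ()
conjuncts3 true  false _     ()
conjuncts3 true  true  false ()

adjacency-forced : ∀ sh m t → adjacency (3 + m) sh t ≡ true → t ≡ forced sh m
adjacency-forced sh012 m (a , b , c) h with conjuncts3 _ _ _ h
... | e₁ , e₂ , e₃ with ≡ᵇ-sound a 0 e₁ | ≡ᵇ-sound b (suc a) e₂ | ≡ᵇ-sound c (suc b) e₃
...   | refl | refl | refl = refl
adjacency-forced sh013 m (a , b , c) h with conjuncts3 _ _ _ h
... | e₁ , e₂ , e₃ with ≡ᵇ-sound a 0 e₁ | ≡ᵇ-sound b (suc a) e₂ | ≡ᵇ-sound (3 + m) (suc c) e₃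
...   | refl | refl | refl = refl
adjacency-forced sh023 m (a , b , c) h with conjuncts3 _ _ _ h
... | e₁ , e₂ , e₃ with ≡ᵇ-sound a 0 e₁ | ≡ᵇ-sound c (suc b) e₂ | ≡ᵇ-sound (3 + m) (suc c) e₃
...   | refl | refl | refl = refl
adjacency-forced sh123 m (a , b , c) h with conjuncts3 _ _ _ h
... | e₁ , e₂ , e₃ with ≡ᵇ-sound b (suc a) e₁ | ≡ᵇ-sound c (suc b) e₂ | ≡ᵇ-sound (3 + m) (suc c) e₃
...   | refl | refl | refl = refl

forced-adjacency : ∀ sh m → adjacency (3 + m) sh (forced sh m) ≡ true
forced-adjacency sh012 m = refl
forced-adjacency sh013 m = ∧-intro (≡ᵇ-refl m) refl
forced-adjacency sh023 m = ∧-intro (≡ᵇ-refl m) (∧-intro (≡ᵇ-refl m) refl)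
forced-adjacency sh123 m = ∧-intro (≡ᵇ-refl m) (∧-intro (≡ᵇ-refl m) (∧-intro (≡ᵇ-refl m) refl))

anyBelow : ℕ → (ℕ → Bool) → Bool
anyBelow zero    h = false
anyBelow (suc n) h = anyBelow n h ∨ h n

anyBelow-cong : ∀ n {h h' : ℕ → Bool} → (∀ a → h a ≡ h' a) → anyBelow n h ≡ anyBelow n h'
anyBelow-cong zero    e = refl
anyBelow-cong (suc n) e = cong₂ _∨_ (anyBelow-cong n e) (e n)

anyBelow-sound : ∀ n h → anyBelow n h ≡ true → Σ[ a ∈ ℕ ] (a < n × h a ≡ true)
anyBelow-sound (suc n) h e with ∨-elim (anyBelow n h) (h n) e
... | inj₂ hn = n , n<1+n n , hn
... | inj₁ e' with anyBelow-sound n h e'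
...   | a , a<n , ha = a , m<n⇒m<1+n a<n , ha

anyBelow-complete : ∀ n h a → a < n → h a ≡ true → anyBelow n h ≡ true
anyBelow-complete (suc n) h a a<1+n ha with m<1+n⇒m<n∨m≡n a<1+n
... | inj₁ a<n  = cong (_∨ h n) (anyBelow-complete n h a a<n ha)
... | inj₂ refl = trans (cong (anyBelow n h ∨_) ha) (∨-zeroʳ (anyBelow n h))

any-++ : ∀ (f : List ℕ → Bool) L M → any f (L ++ M) ≡ (any f L ∨ any f M)
any-++ f []      M = refl
any-++ f (x ∷ L) M = trans (cong (f x ∨_) (any-++ f L M)) (sym (∨-assoc (f x) (any f L) (any f M)))

any-map : ∀ (f : List ℕ → Bool) (h : List ℕ → List ℕ) L → any f (map h L) ≡ any (λ x → f (h x)) L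
any-map f h []      = refl
any-map f h (x ∷ L) = cong (f (h x) ∨_) (any-map f h L)

any-concatMap : ∀ (f : List ℕ → Bool) (g : ℕ → List (List ℕ)) n →
  any f (concatMap g (upTo n)) ≡ anyBelow n (λ a → any f (g a))
any-concatMap f g zero    = refl
any-concatMap f g (suc n) = begin
    any f (concatMap g (upTo (suc n)))             ≡⟨ cong (λ u → any f (concatMap g u)) (sym (upTo-∷ʳ n)) ⟩
    any f (concatMap g (upTo n ++ n ∷ []))         ≡⟨ cong (any f) (concatMap-++ g (upTo n) (n ∷ [])) ⟩
    any f (concatMap g (upTo n) ++ (g n ++ []))    ≡⟨ any-++ f (concatMap g (upTo n)) (g n ++ []) ⟩
    (any f (concatMap g (upTo n)) ∨ any f (g n ++ []))
      ≡⟨ cong₂ _∨_ (any-concatMap f g n) (cong (any f) (++-identityʳ (g n))) ⟩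
    (anyBelow n (λ a → any f (g a)) ∨ any f (g n)) ∎
  where open ≡-Reasoning

any-seqs : ∀ (f : List ℕ → Bool) n m → any f (seqs n (suc m)) ≡ anyBelow n (λ a → any (λ xs → f (a ∷ xs)) (seqs n m))
any-seqs f n m = trans (any-concatMap f (λ a → map (a ∷_) (seqs n m)) n)
                       (anyBelow-cong n (λ a → any-map f (a ∷_) (seqs n m)))

searchTriples-sound : ∀ (f : List ℕ → Bool) n → any f (seqs n 3) ≡ true →
  Σ[ t ∈ Triple ] (Below n t × f (list3 t) ≡ true)
searchTriples-sound f n e with anyBelow-sound n _ (trans (sym (any-seqs f n 2)) e)
... | i , i<n , e₁ with anyBelow-sound n _ (trans (sym (any-seqs (λ xs → f (i ∷ xs)) n 1)) e₁)
...   | j , j<n , e₂ with anyBelow-sound n _ (trans (sym (any-seqs (λ xs → f (i ∷ j ∷ xs)) n 0)) e₂)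
...     | k , k<n , e₃ = (i , j , k) , below , trans (sym (∨-identityʳ _)) e₃
  where
  below : Below n (i , j , k)
  below i0 = i<n
  below i1 = j<n
  below i2 = k<n

searchTriples-complete : ∀ (f : List ℕ → Bool) n t → Below n t → f (list3 t) ≡ true → any f (seqs n 3) ≡ true
searchTriples-complete f n (i , j , k) below e =
  trans (any-seqs f n 2) (anyBelow-complete n _ i (below i0)
   (trans (any-seqs (λ xs → f (i ∷ xs)) n 1) (anyBelow-complete n _ j (below i1)
    (trans (any-seqs (λ xs → f (i ∷ j ∷ xs)) n 0) (anyBelow-complete n _ k (below i2)
      (trans (∨-identityʳ _) e))))))

AllLt-list3 : ∀ n t → Below n t → AllLt n (list3 t) ≡ true
AllLt-list3 n t below = ∧-intro (<ᵇ-true (below i0)) (∧-intro (<ᵇ-true (below i1)) (∧-intro (<ᵇ-true (below i2)) refl))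

AllLt-list3-sound : ∀ n t → AllLt n (list3 t) ≡ true → Below n t
AllLt-list3-sound n (i , j , k) al i0 = <ᵇ-sound i n (∧-conicalˡ _ _ al)
AllLt-list3-sound n (i , j , k) al i1 = <ᵇ-sound j n (∧-conicalˡ (j <ᵇ n) _ (∧-conicalʳ (i <ᵇ n) _ al))
AllLt-list3-sound n (i , j , k) al i2 = <ᵇ-sound k n (∧-conicalˡ (k <ᵇ n) _ (∧-conicalʳ (j <ᵇ n) _ (∧-conicalʳ (i <ᵇ n) _ al)))

increasing-list3 : ∀ t → Increasing t → strictlyIncreasing (list3 t) ≡ true
increasing-list3 (a , b , c) (a<b , b<c) = ∧-intro (<ᵇ-true a<b) (∧-intro (<ᵇ-true b<c) refl)

-- In valuePattern ρ sh the values of an occurrence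
-- are forced by the shape and the positions are free; in positionPattern ρ sh
-- the positions are forced and the values free.  They are exchanged by inverse.
valuePattern positionPattern : Perm3 → Shape → Pattern 3
valuePattern    ρ sh = pat (oneLine ρ) ∅ (shapeSet sh)
positionPattern ρ sh = pat (oneLine ρ) (shapeSet sh) ∅

entriesAt : List ℕ → Triple → Triple
entriesAt π (i , j , k) = at 0 π i , at 0 π j , at 0 π k

forcedWord : Perm3 → Shape → ℕ → List ℕ
forcedWord ρ sh m = list3 (arrange ρ (forced sh m))

occurrenceAt-split : ∀ n π (p : Pattern 3) idx → occurrenceAt n π p idx ≡
  (strictlyIncreasing idx ∧ (orderIso3 (map toℕ (vtoList (σ p))) (map (at 0 π) idx) ∧
    (adjacentPositions n (X p) idx ∧ adjacentValues n (Y p) (sort (map (at 0 π) idx)))))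
occurrenceAt-split n π p idx = refl

valueOccurrence-sound : ∀ ρ sh m π t → occurrenceAt (3 + m) π (valuePattern ρ sh) (list3 t) ≡ true →
  strictlyIncreasing (list3 t) ≡ true × map (at 0 π) (list3 t) ≡ forcedWord ρ sh m
valueOccurrence-sound ρ sh m π t occ =
  ∧-conicalˡ (strictlyIncreasing (list3 t)) _ h ,
  cong list3 (trans (sym (arrange-inverse ρ v)) (cong (arrange ρ) sorted≡forced))
  where
  h : (strictlyIncreasing (list3 t) ∧ (orderIso3 (map toℕ (vtoList (oneLine ρ))) (list3 (entriesAt π t)) ∧
        adjacentValues (3 + m) (shapeSet sh) (sort (list3 (entriesAt π t))))) ≡ true
  h = trans (sym (occurrenceAt-split (3 + m) π (valuePattern ρ sh) (list3 t))) occ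
  v : Triple
  v = entriesAt π t
  ordered∧adjacent : (orderIso3 (map toℕ (vtoList (oneLine ρ))) (list3 v) ∧
                      adjacentValues (3 + m) (shapeSet sh) (sort (list3 v))) ≡ true
  ordered∧adjacent = ∧-conicalʳ (strictlyIncreasing (list3 t)) _ h
  ordered : orderIso3 (map toℕ (vtoList (oneLine ρ))) (list3 v) ≡ true
  ordered = ∧-conicalˡ _ _ ordered∧adjacent
  adjacent : adjacentValues (3 + m) (shapeSet sh) (sort (list3 v)) ≡ true
  adjacent = ∧-conicalʳ (orderIso3 (map toℕ (vtoList (oneLine ρ))) (list3 v)) _ ordered∧adjacent
  sortedV : sort (list3 v) ≡ list3 (arrange (inverse ρ) v)
  sortedV = subst (λ w → sort (list3 w) ≡ list3 (arrange (inverse ρ) v)) (arrange-inverse ρ v)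
                  (sort-arrange ρ _ (orderIso3-sorts ρ v ordered))
  sorted≡forced : arrange (inverse ρ) v ≡ forced sh m
  sorted≡forced = adjacency-forced sh m _ (trans (sym (adjacentValues≡adjacency (3 + m) sh _))
                    (subst (λ s → adjacentValues (3 + m) (shapeSet sh) s ≡ true) sortedV adjacent))

valueOccurrence-complete : ∀ ρ sh m π t → strictlyIncreasing (list3 t) ≡ true → map (at 0 π) (list3 t) ≡ forcedWord ρ sh m →
  occurrenceAt (3 + m) π (valuePattern ρ sh) (list3 t) ≡ true
valueOccurrence-complete ρ sh m π t increasing reads =
  subst (λ w → (strictlyIncreasing (list3 t) ∧ (orderIso3 (map toℕ (vtoList (oneLine ρ))) (list3 w) ∧
                 (true ∧ adjacentValues (3 + m) (shapeSet sh) (sort (list3 w))))) ≡ true)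
    (sym (list3-injective {entriesAt π t} reads))
    (∧-intro increasing (∧-intro (orderIso3-arrange ρ u (forced-increasing sh m))
      (subst (λ s → adjacentValues (3 + m) (shapeSet sh) s ≡ true) (sym (sort-arrange ρ u (forced-increasing sh m)))
        (trans (adjacentValues≡adjacency (3 + m) sh u) (forced-adjacency sh m)))))
  where
  u : Triple
  u = forced sh m

contains-valuePattern : ∀ ρ sh m π → length π ≡ 3 + m →
  contains (3 + m) π (valuePattern ρ sh) ≡ subword (forcedWord ρ sh m) π
contains-valuePattern ρ sh m π len =
  bool-ext (λ h → toSubword (searchTriples-sound occurs (3 + m) h))
           (λ s → fromSubword (subword-sound (forcedWord ρ sh m) π s))
  where
  occurs : List ℕ → Bool
  occurs = occurrenceAt (3 + m) π (valuePattern ρ sh)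
  toSubword : Σ[ t ∈ Triple ] (Below (3 + m) t × occurs (list3 t) ≡ true) → subword (forcedWord ρ sh m) π ≡ true
  toSubword (t , below , occ) =
    subst (λ w → subword w π ≡ true) (proj₂ (valueOccurrence-sound ρ sh m π t occ))
      (subword-complete π (list3 t) (proj₁ (valueOccurrence-sound ρ sh m π t occ))
        (AllLt-list3 (length π) t (subst (λ L → Below L t) (sym len) below)))
  fromSubword : Σ[ idx ∈ List ℕ ] (strictlyIncreasing idx ≡ true × AllLt (length π) idx ≡ true ×
                  map (at 0 π) idx ≡ forcedWord ρ sh m) → any occurs (seqs (3 + m) 3) ≡ true
  fromSubword ([] , _ , _ , ())
  fromSubword (_ ∷ [] , _ , _ , ())
  fromSubword (_ ∷ _ ∷ [] , _ , _ , ())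
  fromSubword (_ ∷ _ ∷ _ ∷ _ ∷ _ , _ , _ , ())
  fromSubword (i ∷ j ∷ k ∷ [] , increasing , al , reads) =
    searchTriples-complete occurs (3 + m) (i , j , k)
      (AllLt-list3-sound (3 + m) (i , j , k) (subst (λ L → AllLt L (i ∷ j ∷ k ∷ []) ≡ true) len al))
      (valueOccurrence-complete ρ sh m π (i , j , k) increasing reads)

positionOccurrence-sound : ∀ ρ sh m π t → occurrenceAt (3 + m) π (positionPattern ρ sh) (list3 t) ≡ true →
  t ≡ forced sh m × orderIso3 (map toℕ (vtoList (oneLine ρ))) (list3 (entriesAt π t)) ≡ true
positionOccurrence-sound ρ sh m π t occ =
  adjacency-forced sh m t (trans (sym (adjacentPositions≡adjacency (3 + m) sh t)) adjacent) , ordered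
  where
  h : (strictlyIncreasing (list3 t) ∧ (orderIso3 (map toℕ (vtoList (oneLine ρ))) (list3 (entriesAt π t)) ∧
        (adjacentPositions (3 + m) (shapeSet sh) (list3 t) ∧ true))) ≡ true
  h = trans (sym (occurrenceAt-split (3 + m) π (positionPattern ρ sh) (list3 t))) occ
  ordered∧adjacent : (orderIso3 (map toℕ (vtoList (oneLine ρ))) (list3 (entriesAt π t)) ∧
                      (adjacentPositions (3 + m) (shapeSet sh) (list3 t) ∧ true)) ≡ true
  ordered∧adjacent = ∧-conicalʳ (strictlyIncreasing (list3 t)) _ h
  ordered : orderIso3 (map toℕ (vtoList (oneLine ρ))) (list3 (entriesAt π t)) ≡ true
  ordered = ∧-conicalˡ _ _ ordered∧adjacent
  adjacent : adjacentPositions (3 + m) (shapeSet sh) (list3 t) ≡ true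
  adjacent = ∧-conicalˡ _ _ (∧-conicalʳ (orderIso3 (map toℕ (vtoList (oneLine ρ))) (list3 (entriesAt π t))) _ ordered∧adjacent)

contains-positionPattern : ∀ ρ sh m π →
  contains (3 + m) π (positionPattern ρ sh) ≡ increasing? (arrange (inverse ρ) (entriesAt π (forced sh m)))
contains-positionPattern ρ sh m π =
  trans (bool-ext (λ h → toOrdered (searchTriples-sound occurs (3 + m) h)) fromOrdered) (orderIso3≡sorted ρ _)
  where
  occurs : List ℕ → Bool
  occurs = occurrenceAt (3 + m) π (positionPattern ρ sh)
  ordered : Bool
  ordered = orderIso3 (map toℕ (vtoList (oneLine ρ))) (list3 (entriesAt π (forced sh m)))
  toOrdered : Σ[ t ∈ Triple ] (Below (3 + m) t × occurs (list3 t) ≡ true) → ordered ≡ true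
  toOrdered (t , _ , occ) = subst (λ u → orderIso3 (map toℕ (vtoList (oneLine ρ))) (list3 (entriesAt π u)) ≡ true)
    (proj₁ (positionOccurrence-sound ρ sh m π t occ)) (proj₂ (positionOccurrence-sound ρ sh m π t occ))
  fromOrdered : ordered ≡ true → any occurs (seqs (3 + m) 3) ≡ true
  fromOrdered o = searchTriples-complete occurs (3 + m) (forced sh m) (forced-below sh m)
    (trans (occurrenceAt-split (3 + m) π (positionPattern ρ sh) (list3 (forced sh m)))
      (∧-intro (increasing-list3 _ (forced-increasing sh m))
        (∧-intro o (∧-intro (trans (adjacentPositions≡adjacency (3 + m) sh (forced sh m)) (forced-adjacency sh m)) refl))))

Σ³ : ℕ → (ℕ → ℕ → ℕ → ℕ) → ℕ
Σ³ n f = Σn n (λ a → Σn n (λ b → Σn n (λ c → f a b c)))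

Σ³-cong : ∀ n {f g : ℕ → ℕ → ℕ → ℕ} → (∀ a b c → a < n → b < n → c < n → f a b c ≡ g a b c) → Σ³ n f ≡ Σ³ n g
Σ³-cong n h = Σ-cong n (λ a a<n → Σ-cong n (λ b b<n → Σ-cong n (λ c c<n → h a b c a<n b<n c<n)))

Σ³-*r : ∀ n f k → Σ³ n (λ a b c → f a b c * k) ≡ Σ³ n f * k
Σ³-*r n f k = trans (Σ-cong n (λ a _ → trans (Σ-cong n (λ b _ → Σ-*r n (f a b) k)) (Σ-*r n _ k))) (Σ-*r n _ k)

Σ³-+ : ∀ n (f g : ℕ → ℕ → ℕ → ℕ) → Σ³ n (λ a b c → f a b c + g a b c) ≡ Σ³ n f + Σ³ n g
Σ³-+ n f g = trans (Σ-cong n (λ a _ → trans (Σ-cong n (λ b _ → Σ-+ n (f a b) (g a b))) (Σ-+ n _ _))) (Σ-+ n _ _)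

Σ³-swapInner : ∀ n (f : ℕ → ℕ → ℕ → ℕ) → Σ³ n f ≡ Σ³ n (λ a c b → f a b c)
Σ³-swapInner n f = Σ-cong n (λ a _ → Σ-swap n n (λ b c → f a b c))

Σ³-swapOuter : ∀ n (f : ℕ → ℕ → ℕ → ℕ) → Σ³ n f ≡ Σ³ n (λ b a c → f a b c)
Σ³-swapOuter n f = Σ-swap n n (λ a b → Σn n (λ c → f a b c))

Σ³-arrange : ∀ n ρ (g : Triple → ℕ) → Σ³ n (λ a b c → g (arrange ρ (a , b , c))) ≡ Σ³ n (λ a b c → g (a , b , c))
Σ³-arrange n p012 g = refl
Σ³-arrange n p021 g = Σ³-swapInner n (λ a b c → g (a , c , b))
Σ³-arrange n p102 g = Σ³-swapOuter n (λ a b c → g (b , a , c))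
Σ³-arrange n p120 g = trans (Σ³-swapOuter n (λ a b c → g (b , c , a))) (Σ³-swapInner n (λ b a c → g (b , c , a)))
Σ³-arrange n p201 g = trans (Σ³-swapInner n (λ a b c → g (c , a , b))) (Σ³-swapOuter n (λ a c b → g (c , a , b)))
Σ³-arrange n p210 g = trans (Σ³-swapInner n (λ a b c → g (c , b , a)))
                     (trans (Σ³-swapOuter n (λ a c b → g (c , b , a))) (Σ³-swapInner n (λ c a b → g (c , b , a))))

perms3 : List Perm3
perms3 = p012 ∷ p021 ∷ p102 ∷ p120 ∷ p201 ∷ p210 ∷ []

sortings : Triple → ℕ
sortings t = sum (map (λ ρ → ind (increasing? (arrange (inverse ρ) t))) perms3)

compare3 : ℕ → ℕ → Bool × Bool × Bool
compare3 x y = (x <ᵇ y) , (y <ᵇ x) , (y ≡ᵇ x)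

compare3-< : ∀ {x y} → x < y → compare3 x y ≡ (true , false , false)
compare3-< x<y = cong₂ _,_ (<ᵇ-true x<y) (cong₂ _,_ (<ᵇ-false (<⇒≯ x<y)) (≡ᵇ-false (λ y≡x → <-irrefl (sym y≡x) x<y)))

compare3-> : ∀ {x y} → y < x → compare3 x y ≡ (false , true , false)
compare3-> y<x = cong₂ _,_ (<ᵇ-false (<⇒≯ y<x)) (cong₂ _,_ (<ᵇ-true y<x) (≡ᵇ-false (λ y≡x → <-irrefl y≡x y<x)))

compare3-≡ : ∀ x → compare3 x x ≡ (false , false , true)
compare3-≡ x = cong₂ _,_ (<ᵇ-false (n≮n x)) (cong₂ _,_ (<ᵇ-false (n≮n x)) (≡ᵇ-refl x))

-- sortings (x , y , z) and the distinctness of x, y, z, as functions of the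
-- comparison outcomes of the pairs (x , y), (y , z), (x , z).
sortingsOf : Bool × Bool × Bool → Bool × Bool × Bool → Bool × Bool × Bool → ℕ
sortingsOf (x<y , y<x , _) (y<z , z<y , _) (x<z , z<x , _) =
  ind (x<y ∧ y<z) + (ind (x<z ∧ z<y) + (ind (y<x ∧ x<z) + (ind (z<x ∧ x<y) + (ind (y<z ∧ z<x) + (ind (z<y ∧ y<x) + 0)))))

distinctOf : Bool × Bool × Bool → Bool × Bool × Bool → Bool × Bool × Bool → ℕ
distinctOf (_ , _ , y≡x) (_ , _ , z≡y) (_ , _ , z≡x) = ind (not (y≡x ∨ false) ∧ (not (z≡y ∨ (z≡x ∨ false)) ∧ true))

orderType : ∀ {c₁ c₂ c₃ v₁ v₂ v₃} → c₁ ≡ v₁ → c₂ ≡ v₂ → c₃ ≡ v₃ →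
  sortingsOf v₁ v₂ v₃ ≡ distinctOf v₁ v₂ v₃ → sortingsOf c₁ c₂ c₃ ≡ distinctOf c₁ c₂ c₃
orderType refl refl refl h = h

-- A triple of distinct numbers is sorted by exactly one permutation; a triple
-- with a repetition by none.  Checked on the thirteen order types of (x , y , z).
sortings-distinct : ∀ x y z → sortings (x , y , z) ≡ ind (fresh [] (x ∷ y ∷ z ∷ []))
sortings-distinct x y z with <-cmp x y | <-cmp y z
... | tri< x<y _ _  | tri< y<z _ _  = orderType (compare3-< x<y) (compare3-< y<z) (compare3-< (<-trans x<y y<z)) refl
... | tri< x<y _ _  | tri≈ _ refl _ = orderType (compare3-< x<y) (compare3-≡ y) (compare3-< x<y) refl
... | tri≈ _ refl _ | tri< y<z _ _  = orderType (compare3-≡ x) (compare3-< y<z) (compare3-< y<z) refl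
... | tri≈ _ refl _ | tri≈ _ refl _ = orderType (compare3-≡ x) (compare3-≡ x) (compare3-≡ x) refl
... | tri≈ _ refl _ | tri> _ _ z<y  = orderType (compare3-≡ x) (compare3-> z<y) (compare3-> z<y) refl
... | tri> _ _ y<x  | tri≈ _ refl _ = orderType (compare3-> y<x) (compare3-≡ y) (compare3-> y<x) refl
... | tri> _ _ y<x  | tri> _ _ z<y  = orderType (compare3-> y<x) (compare3-> z<y) (compare3-> (<-trans z<y y<x)) refl
... | tri< x<y _ _  | tri> _ _ z<y with <-cmp x z
...   | tri< x<z _ _  = orderType (compare3-< x<y) (compare3-> z<y) (compare3-< x<z) refl
...   | tri≈ _ refl _ = orderType (compare3-< x<y) (compare3-> z<y) (compare3-≡ x) refl
...   | tri> _ _ z<x  = orderType (compare3-< x<y) (compare3-> z<y) (compare3-> z<x) refl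
sortings-distinct x y z | tri> _ _ y<x | tri< y<z _ _ with <-cmp x z
...   | tri< x<z _ _  = orderType (compare3-> y<x) (compare3-< y<z) (compare3-< x<z) refl
...   | tri≈ _ refl _ = orderType (compare3-> y<x) (compare3-< y<z) (compare3-≡ x) refl
...   | tri> _ _ z<x  = orderType (compare3-> y<x) (compare3-< y<z) (compare3-> z<x) refl


Σ³-sum : ∀ n (L : List Perm3) (g : Perm3 → ℕ → ℕ → ℕ → ℕ) →
  Σ³ n (λ a b c → sum (map (λ ρ → g ρ a b c) L)) ≡ sum (map (λ ρ → Σ³ n (g ρ)) L)
Σ³-sum n []      g = Σ-zero n (λ a _ → Σ-zero n (λ b _ → Σ-zero n (λ c _ → refl)))
Σ³-sum n (ρ ∷ L) g = trans (Σ³-+ n (g ρ) _) (cong (Σ³ n (g ρ) +_) (Σ³-sum n L g))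

-- Summing sortings-distinct over all triples: each of the six relative orders is
-- taken by as many triples as the increasing one, so 6 · #increasing = #distinct.
six-increasing : ∀ n → 6 * Σ³ n (λ a b c → ind (increasing? (a , b , c))) ≡ Σ³ n (λ a b c → ind (fresh [] (a ∷ b ∷ c ∷ [])))
six-increasing n = sym (begin
    Σ³ n (λ a b c → ind (fresh [] (a ∷ b ∷ c ∷ [])))
      ≡⟨ Σ³-cong n (λ a b c _ _ _ → sym (sortings-distinct a b c)) ⟩
    Σ³ n (λ a b c → sortings (a , b , c))
      ≡⟨ Σ³-sum n perms3 (λ ρ a b c → ind (increasing? (arrange (inverse ρ) (a , b , c)))) ⟩
    sum (map (λ ρ → Σ³ n (λ a b c → ind (increasing? (arrange (inverse ρ) (a , b , c))))) perms3)
      ≡⟨ cong sum (map-cong (λ ρ → Σ³-arrange n (inverse ρ) (λ t → ind (increasing? t))) perms3) ⟩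
    sum (map (λ _ → increasingTriples) perms3)
      ≡⟨⟩
    6 * increasingTriples ∎)
  where
  open ≡-Reasoning
  increasingTriples : ℕ
  increasingTriples = Σ³ n (λ a b c → ind (increasing? (a , b , c)))

ind-∧∧ : ∀ p q → ind (p ∧ (q ∧ true)) ≡ ind p * ind q
ind-∧∧ true  true  = refl
ind-∧∧ true  false = refl
ind-∧∧ false q     = refl

count-distinct-triples : ∀ m → Σ³ (3 + m) (λ a b c → ind (fresh [] (a ∷ b ∷ c ∷ []))) ≡ (3 + m) * ((2 + m) * (1 + m))
count-distinct-triples m = begin
    Σ³ n (λ a b c → ind (fresh [] (a ∷ b ∷ c ∷ [])))
      ≡⟨ Σ³-cong n (λ a b c _ _ _ → ind-∧∧ (not (elem b (a ∷ []))) (not (elem c (b ∷ a ∷ [])))) ⟩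
    Σ³ n (λ a b c → ind (not (elem b (a ∷ []))) * ind (not (elem c (b ∷ a ∷ []))))
      ≡⟨ Σ-cong n (λ a _ → Σ-cong n (λ b _ → Σ-*l n (λ c → ind (not (elem c (b ∷ a ∷ [])))) (ind (not (elem b (a ∷ [])))))) ⟩
    Σn n (λ a → Σn n (λ b → ind (not (elem b (a ∷ []))) * Σn n (λ c → ind (not (elem c (b ∷ a ∷ []))))))
      ≡⟨ Σ-cong n (λ a a<n → Σ-cong n (λ b b<n → third a b a<n b<n)) ⟩
    Σn n (λ a → Σn n (λ b → ind (not (elem b (a ∷ []))) * (1 + m)))
      ≡⟨ Σ-cong n (λ a a<n → trans (Σ-*r n _ (1 + m)) (cong (_* (1 + m)) (avoiding n (a ∷ []) (single a a<n)))) ⟩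
    Σn n (λ _ → (2 + m) * (1 + m))
      ≡⟨ Σ-const n _ ⟩
    (3 + m) * ((2 + m) * (1 + m)) ∎
  where
  open ≡-Reasoning
  n : ℕ
  n = 3 + m
  single : ∀ a → a < n → DistinctBelow n (a ∷ [])
  single a a<n = DistinctBelow-∷ n a [] a<n refl (DistinctBelow-[] n)
  third : ∀ a b → a < n → b < n →
    ind (not (elem b (a ∷ []))) * Σn n (λ c → ind (not (elem c (b ∷ a ∷ [])))) ≡ ind (not (elem b (a ∷ []))) * (1 + m)
  third a b a<n b<n with elem b (a ∷ []) in b∈a
  ... | true  = refl
  ... | false = cong (1 *_) (avoiding n (b ∷ a ∷ []) (DistinctBelow-∷ n b (a ∷ []) b<n b∈a (single a a<n)))

Distinct3 : Triple → Set
Distinct3 (a , b , c) = a ≢ b × b ≢ c × a ≢ c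

increasing-distinct : ∀ u → Increasing u → Distinct3 u
increasing-distinct (a , b , c) (a<b , b<c) = (λ e → <-irrefl e a<b) , (λ e → <-irrefl e b<c) , (λ e → <-irrefl e (<-trans a<b b<c))

arrange-distinct : ∀ ρ u → Distinct3 u → Distinct3 (arrange ρ u)
arrange-distinct p012 (a , b , c) (a≢b , b≢c , a≢c) = a≢b , b≢c , a≢c
arrange-distinct p021 (a , b , c) (a≢b , b≢c , a≢c) = a≢c , ≢-sym b≢c , a≢b
arrange-distinct p102 (a , b , c) (a≢b , b≢c , a≢c) = ≢-sym a≢b , a≢c , b≢c
arrange-distinct p120 (a , b , c) (a≢b , b≢c , a≢c) = b≢c , ≢-sym a≢c , ≢-sym a≢b
arrange-distinct p201 (a , b , c) (a≢b , b≢c , a≢c) = ≢-sym a≢c , a≢b , ≢-sym b≢c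
arrange-distinct p210 (a , b , c) (a≢b , b≢c , a≢c) = ≢-sym b≢c , ≢-sym a≢b , ≢-sym a≢c

arrange-below : ∀ n ρ u → Below n u → Below n (arrange ρ u)
arrange-below n ρ u below i = subst (_< n) (sym (pick-arrange ρ u i)) (below (slot ρ i))

list3-distinctBelow : ∀ n t → Below n t → Distinct3 t → DistinctBelow n (list3 t)
list3-distinctBelow n (a , b , c) below (a≢b , b≢c , a≢c) =
  DistinctBelow-∷ n a (b ∷ c ∷ []) (below i0) (cong₂ _∨_ (≡ᵇ-false a≢b) (cong (_∨ false) (≡ᵇ-false a≢c)))
    (DistinctBelow-∷ n b (c ∷ []) (below i1) (cong (_∨ false) (≡ᵇ-false b≢c))
      (DistinctBelow-∷ n c [] (below i2) refl (DistinctBelow-[] n)))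

list3-distinct : ∀ t → Distinct3 t → distinct (list3 t) ≡ true
list3-distinct (a , b , c) (a≢b , b≢c , a≢c) = cong₂ (λ u v → not u ∧ (not v ∧ true))
   (cong₂ _∨_ (≡ᵇ-false a≢b) (cong (_∨ false) (≡ᵇ-false a≢c))) (cong (_∨ false) (≡ᵇ-false b≢c))

count-startingWith3 : ∀ m p q r (β : Bool) → (β ≡ true → Distinct3 (p , q , r)) →
  p < 3 + m → q < 3 + m → r < 3 + m → count (3 + m) m (λ xs → fresh [] (p ∷ q ∷ r ∷ xs) ∧ β) ≡ ind β * m !
count-startingWith3 m p q r false _        _   _   _   = count-false (3 + m) m _ (λ xs → ∧-zeroʳ _)
count-startingWith3 m p q r true  β-distinct p<n q<n r<n =
  trans (count-cong (3 + m) m (λ xs _ _ → trans (∧-identityʳ _) (restFresh xs)))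
        (trans (count-fresh (3 + m) m (r ∷ q ∷ p ∷ []) used refl) (sym (+-identityʳ _)))
  where
  p≢q : p ≢ q
  p≢q = proj₁ (β-distinct refl)
  q≢r : q ≢ r
  q≢r = proj₁ (proj₂ (β-distinct refl))
  p≢r : p ≢ r
  p≢r = proj₂ (proj₂ (β-distinct refl))
  q∉p : elem q (p ∷ []) ≡ false
  q∉p = cong (_∨ false) (≡ᵇ-false (≢-sym p≢q))
  r∉qp : elem r (q ∷ p ∷ []) ≡ false
  r∉qp = cong₂ _∨_ (≡ᵇ-false (≢-sym q≢r)) (cong (_∨ false) (≡ᵇ-false (≢-sym p≢r)))
  restFresh : ∀ xs → fresh [] (p ∷ q ∷ r ∷ xs) ≡ fresh (r ∷ q ∷ p ∷ []) xs
  restFresh xs = cong₂ (λ u v → not u ∧ (not v ∧ fresh (r ∷ q ∷ p ∷ []) xs)) q∉p r∉qp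
  used : DistinctBelow (3 + m) (r ∷ q ∷ p ∷ [])
  used = DistinctBelow-∷ _ r (q ∷ p ∷ []) r<n r∉qp
           (DistinctBelow-∷ _ q (p ∷ []) q<n q∉p (DistinctBelow-∷ _ p [] p<n refl (DistinctBelow-[] (3 + m))))

length-∷ʳ : ∀ (xs : List ℕ) c → length (xs ∷ʳ c) ≡ suc (length xs)
length-∷ʳ []       c = refl
length-∷ʳ (x ∷ xs) c = cong suc (length-∷ʳ xs c)

at-snoc : ∀ (xs : List ℕ) c m → length xs ≡ m → at 0 (xs ∷ʳ c) m ≡ c
at-snoc []       c .0                   refl = refl
at-snoc (x ∷ xs) c .(suc (length xs)) refl = at-snoc xs c (length xs) refl

at-snoc-lt : ∀ (xs : List ℕ) c i → i < length xs → at 0 (xs ∷ʳ c) i ≡ at 0 xs i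
at-snoc-lt (x ∷ xs) c zero    _         = refl
at-snoc-lt (x ∷ xs) c (suc i) (s≤s i<) = at-snoc-lt xs c i i<

-- The forced positions
-- are peeled off first (from the front or, via count-snoc, from the back).
count-prescribed : ∀ sh m (G : Triple → Bool) → (∀ t → G t ≡ true → Distinct3 t) →
  count (3 + m) (3 + m) (λ π → fresh [] π ∧ G (entriesAt π (forced sh m))) ≡ Σ³ (3 + m) (λ a b c → ind (G (a , b , c))) * m !
count-prescribed sh012 m G G-distinct = begin
    count n (3 + m) Q
      ≡⟨ count-cons n (2 + m) Q ⟩
    Σn n (λ a → count n (2 + m) (λ xs → Q (a ∷ xs)))
      ≡⟨ Σ-cong n (λ a _ → count-cons n (1 + m) _) ⟩
    Σn n (λ a → Σn n (λ b → count n (1 + m) (λ xs → Q (a ∷ b ∷ xs))))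
      ≡⟨ Σ-cong n (λ a _ → Σ-cong n (λ b _ → count-cons n m _)) ⟩
    Σ³ n (λ a b c → count n m (λ xs → Q (a ∷ b ∷ c ∷ xs)))
      ≡⟨ Σ³-cong n (λ a b c a<n b<n c<n → count-startingWith3 m a b c (G (a , b , c)) (G-distinct _) a<n b<n c<n) ⟩
    Σ³ n (λ a b c → ind (G (a , b , c)) * m !)
      ≡⟨ Σ³-*r n _ (m !) ⟩
    Σ³ n (λ a b c → ind (G (a , b , c))) * m ! ∎
  where
  open ≡-Reasoning
  n : ℕ
  n = 3 + m
  Q : List ℕ → Bool
  Q π = fresh [] π ∧ G (entriesAt π (forced sh012 m))
count-prescribed sh013 m G G-distinct = begin
    count n (3 + m) Q
      ≡⟨ count-cons n (2 + m) Q ⟩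
    Σn n (λ a → count n (2 + m) (λ xs → Q (a ∷ xs)))
      ≡⟨ Σ-cong n (λ a _ → count-cons n (1 + m) _) ⟩
    Σn n (λ a → Σn n (λ b → count n (1 + m) (λ xs → Q (a ∷ b ∷ xs))))
      ≡⟨ Σ-cong n (λ a _ → Σ-cong n (λ b _ → count-snoc n m _)) ⟩
    Σ³ n (λ a b c → count n m (λ xs → Q (a ∷ b ∷ (xs ∷ʳ c))))
      ≡⟨ Σ³-cong n (λ a b c a<n b<n c<n → trans (count-cong n m (λ xs len _ → reorder a b c xs len))
                                                (count-startingWith3 m a b c (G (a , b , c)) (G-distinct _) a<n b<n c<n)) ⟩
    Σ³ n (λ a b c → ind (G (a , b , c)) * m !)
      ≡⟨ Σ³-*r n _ (m !) ⟩
    Σ³ n (λ a b c → ind (G (a , b , c))) * m ! ∎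
  where
  open ≡-Reasoning
  n : ℕ
  n = 3 + m
  Q : List ℕ → Bool
  Q π = fresh [] π ∧ G (entriesAt π (forced sh013 m))
  reorder : ∀ a b c xs → length xs ≡ m → Q (a ∷ b ∷ (xs ∷ʳ c)) ≡ (fresh [] (a ∷ b ∷ c ∷ xs) ∧ G (a , b , c))
  reorder a b c xs len = cong₂ _∧_
    (cong (λ g → not (elem a []) ∧ (not (elem b (a ∷ [])) ∧ g)) (fresh-snoc (b ∷ a ∷ []) xs c))
    (cong (λ z → G (a , b , z)) (at-snoc xs c m len))
count-prescribed sh023 m G G-distinct = begin
    count n (3 + m) Q
      ≡⟨ count-cons n (2 + m) Q ⟩
    Σn n (λ a → count n (2 + m) (λ xs → Q (a ∷ xs)))
      ≡⟨ Σ-cong n (λ a _ → count-snoc n (1 + m) _) ⟩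
    Σn n (λ a → Σn n (λ c → count n (1 + m) (λ ys → Q (a ∷ (ys ∷ʳ c)))))
      ≡⟨ Σ-cong n (λ a _ → Σ-cong n (λ c _ → count-snoc n m _)) ⟩
    Σ³ n (λ a c b → count n m (λ xs → Q (a ∷ ((xs ∷ʳ b) ∷ʳ c))))
      ≡⟨ Σ³-cong n (λ a c b a<n c<n b<n → trans (count-cong n m (λ xs len _ → reorder a b c xs len))
             (count-startingWith3 m a c b (G (a , b , c)) (λ e → swap23 (G-distinct _ e)) a<n c<n b<n)) ⟩
    Σ³ n (λ a c b → ind (G (a , b , c)) * m !)
      ≡⟨ sym (Σ³-swapInner n _) ⟩
    Σ³ n (λ a b c → ind (G (a , b , c)) * m !)
      ≡⟨ Σ³-*r n _ (m !) ⟩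
    Σ³ n (λ a b c → ind (G (a , b , c))) * m ! ∎
  where
  open ≡-Reasoning
  n : ℕ
  n = 3 + m
  Q : List ℕ → Bool
  Q π = fresh [] π ∧ G (entriesAt π (forced sh023 m))
  swap23 : ∀ {a b c} → Distinct3 (a , b , c) → Distinct3 (a , c , b)
  swap23 (a≢b , b≢c , a≢c) = a≢c , ≢-sym b≢c , a≢b
  reorder : ∀ a b c xs → length xs ≡ m → Q (a ∷ ((xs ∷ʳ b) ∷ʳ c)) ≡ (fresh [] (a ∷ c ∷ b ∷ xs) ∧ G (a , b , c))
  reorder a b c xs len = cong₂ _∧_
    (cong (λ g → not (elem a []) ∧ g) (trans (fresh-snoc (a ∷ []) (xs ∷ʳ b) c)
        (cong (λ g → not (elem c (a ∷ [])) ∧ g) (fresh-snoc (c ∷ a ∷ []) xs b))))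
    (cong₂ (λ y z → G (a , y , z))
       (trans (at-snoc-lt (xs ∷ʳ b) c m (subst (m <_) (sym len₁) (n<1+n m))) (at-snoc xs b m len))
       (at-snoc (xs ∷ʳ b) c (suc m) len₁))
    where
    len₁ : length (xs ∷ʳ b) ≡ suc m
    len₁ = trans (length-∷ʳ xs b) (cong suc len)
count-prescribed sh123 m G G-distinct = begin
    count n (3 + m) Q
      ≡⟨ count-snoc n (2 + m) Q ⟩
    Σn n (λ c → count n (2 + m) (λ xs → Q (xs ∷ʳ c)))
      ≡⟨ Σ-cong n (λ c _ → count-snoc n (1 + m) _) ⟩
    Σn n (λ c → Σn n (λ b → count n (1 + m) (λ ys → Q ((ys ∷ʳ b) ∷ʳ c))))
      ≡⟨ Σ-cong n (λ c _ → Σ-cong n (λ b _ → count-snoc n m _)) ⟩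
    Σ³ n (λ c b a → count n m (λ xs → Q (((xs ∷ʳ a) ∷ʳ b) ∷ʳ c)))
      ≡⟨ Σ³-cong n (λ c b a c<n b<n a<n → trans (count-cong n m (λ xs len _ → reorder a b c xs len))
             (count-startingWith3 m c b a (G (a , b , c)) (λ e → reverse3 (G-distinct _ e)) c<n b<n a<n)) ⟩
    Σ³ n (λ c b a → ind (G (a , b , c)) * m !)
      ≡⟨ Σ³-arrange n p210 (λ t → ind (G t) * m !) ⟩
    Σ³ n (λ a b c → ind (G (a , b , c)) * m !)
      ≡⟨ Σ³-*r n _ (m !) ⟩
    Σ³ n (λ a b c → ind (G (a , b , c))) * m ! ∎
  where
  open ≡-Reasoning
  n : ℕ
  n = 3 + m
  Q : List ℕ → Bool
  Q π = fresh [] π ∧ G (entriesAt π (forced sh123 m))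
  reverse3 : ∀ {a b c} → Distinct3 (a , b , c) → Distinct3 (c , b , a)
  reverse3 (a≢b , b≢c , a≢c) = ≢-sym b≢c , ≢-sym a≢b , ≢-sym a≢c
  reorder : ∀ a b c xs → length xs ≡ m → Q (((xs ∷ʳ a) ∷ʳ b) ∷ʳ c) ≡ (fresh [] (c ∷ b ∷ a ∷ xs) ∧ G (a , b , c))
  reorder a b c xs len = cong₂ _∧_
    (trans (fresh-snoc [] ((xs ∷ʳ a) ∷ʳ b) c)
      (cong (λ g → not (elem c []) ∧ g) (trans (fresh-snoc (c ∷ []) (xs ∷ʳ a) b)
        (cong (λ g → not (elem b (c ∷ [])) ∧ g) (fresh-snoc (b ∷ c ∷ []) xs a)))))
    (cong₂ (λ x yz → G (x , yz))
      (trans (at-snoc-lt ((xs ∷ʳ a) ∷ʳ b) c m (subst (m <_) (sym len₂) (<-trans (n<1+n m) (n<1+n (suc m)))))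
        (trans (at-snoc-lt (xs ∷ʳ a) b m (subst (m <_) (sym len₁) (n<1+n m))) (at-snoc xs a m len)))
      (cong₂ _,_
        (trans (at-snoc-lt ((xs ∷ʳ a) ∷ʳ b) c (suc m) (subst (suc m <_) (sym len₂) (n<1+n (suc m))))
          (at-snoc (xs ∷ʳ a) b (suc m) len₁))
        (at-snoc ((xs ∷ʳ a) ∷ʳ b) c (suc (suc m)) len₂)))
    where
    len₁ : length (xs ∷ʳ a) ≡ suc m
    len₁ = trans (length-∷ʳ xs a) (cong suc len)
    len₂ : length ((xs ∷ʳ a) ∷ʳ b) ≡ suc (suc m)
    len₂ = trans (length-∷ʳ (xs ∷ʳ a) b) (cong suc len₁)

count-valuePattern : ∀ ρ sh m →
  6 * count (3 + m) (3 + m) (λ π → isPerm (3 + m) π ∧ contains (3 + m) π (valuePattern ρ sh)) ≡ (3 + m) !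
count-valuePattern ρ sh m = begin
    6 * count n n (λ π → isPerm n π ∧ contains n π (valuePattern ρ sh))
      ≡⟨ cong (6 *_) (count-cong n n (λ π len al →
           cong₂ _∧_ (isPerm≡fresh n π len al) (contains-valuePattern ρ sh m π len))) ⟩
    6 * count n n (λ π → fresh [] π ∧ subword (forcedWord ρ sh m) π)
      ≡⟨ count-fresh-subword n n [] (list3 u) (list3-distinctBelow n u below u-distinct) (disjoint-[] (list3 u))
           (list3-distinct u u-distinct) (AllLt-list3 n u below) refl ⟩
    n ! ∎
  where
  open ≡-Reasoning
  n : ℕ
  n = 3 + m
  u : Triple
  u = arrange ρ (forced sh m)
  below : Below n u
  below = arrange-below n ρ (forced sh m) (forced-below sh m)
  u-distinct : Distinct3 u
  u-distinct = arrange-distinct ρ (forced sh m) (increasing-distinct _ (forced-increasing sh m))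

count-positionPattern : ∀ ρ sh m →
  6 * count (3 + m) (3 + m) (λ π → isPerm (3 + m) π ∧ contains (3 + m) π (positionPattern ρ sh)) ≡ (3 + m) !
count-positionPattern ρ sh m = begin
    6 * count n n (λ π → isPerm n π ∧ contains n π (positionPattern ρ sh))
      ≡⟨ cong (6 *_) (count-cong n n (λ π len al →
           cong₂ _∧_ (isPerm≡fresh n π len al) (contains-positionPattern ρ sh m π))) ⟩
    6 * count n n (λ π → fresh [] π ∧ sortedBy (entriesAt π (forced sh m)))
      ≡⟨ cong (6 *_) (count-prescribed sh m sortedBy sortedBy-distinct) ⟩
    6 * (Σ³ n (λ a b c → ind (sortedBy (a , b , c))) * m !)
      ≡⟨ cong (λ k → 6 * (k * m !)) (Σ³-arrange n (inverse ρ) (λ t → ind (increasing? t))) ⟩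
    6 * (increasingTriples * m !)
      ≡⟨ sym (*-assoc 6 increasingTriples (m !)) ⟩
    6 * increasingTriples * m !
      ≡⟨ cong (_* m !) (trans (six-increasing n) (count-distinct-triples m)) ⟩
    (3 + m) * ((2 + m) * (1 + m)) * m !
      ≡⟨ trans (*-assoc (3 + m) ((2 + m) * (1 + m)) (m !)) (cong ((3 + m) *_) (*-assoc (2 + m) (1 + m) (m !))) ⟩
    (3 + m) ! ∎
  where
  open ≡-Reasoning
  n : ℕ
  n = 3 + m
  increasingTriples : ℕ
  increasingTriples = Σ³ n (λ a b c → ind (increasing? (a , b , c)))
  sortedBy : Triple → Bool
  sortedBy t = increasing? (arrange (inverse ρ) t)
  sortedBy-distinct : ∀ t → sortedBy t ≡ true → Distinct3 t
  sortedBy-distinct t e = subst Distinct3 (arrange-inverse ρ t)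
    (arrange-distinct ρ _ (increasing-distinct _ (increasing?-sound _ e)))

Covered : Pattern 3 → Set
Covered p = Σ[ ρ ∈ Perm3 ] Σ[ sh ∈ Shape ] (p ≡ valuePattern ρ sh ⊎ p ≡ positionPattern ρ sh)

reverse complement : Perm3 → Perm3
reverse p012 = p210
reverse p021 = p120
reverse p102 = p201
reverse p120 = p021
reverse p201 = p102
reverse p210 = p012
complement p012 = p210
complement p021 = p201
complement p102 = p120
complement p120 = p102
complement p201 = p021
complement p210 = p012

mirror : Shape → Shape
mirror sh012 = sh123
mirror sh013 = sh023
mirror sh023 = sh013
mirror sh123 = sh012

reverse-oneLine : ∀ ρ → V.reverse (oneLine ρ) ≡ oneLine (reverse ρ)
reverse-oneLine p012 = refl
reverse-oneLine p021 = refl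
reverse-oneLine p102 = refl
reverse-oneLine p120 = refl
reverse-oneLine p201 = refl
reverse-oneLine p210 = refl

complement-oneLine : ∀ ρ → V.map F.opposite (oneLine ρ) ≡ oneLine (complement ρ)
complement-oneLine p012 = refl
complement-oneLine p021 = refl
complement-oneLine p102 = refl
complement-oneLine p120 = refl
complement-oneLine p201 = refl
complement-oneLine p210 = refl

reverse-shapeSet : ∀ sh → V.reverse (shapeSet sh) ≡ shapeSet (mirror sh)
reverse-shapeSet sh012 = refl
reverse-shapeSet sh013 = refl
reverse-shapeSet sh023 = refl
reverse-shapeSet sh123 = refl

oneLine-inverse : ∀ ρ (v : Vec (Fin 3) 3) → (∀ k → V.lookup v (V.lookup (oneLine ρ) k) ≡ k) → v ≡ oneLine (inverse ρ)
oneLine-inverse ρ (a V.∷ b V.∷ c V.∷ V.[]) inv = byCases ρ a b c (inv F.zero) (inv (F.suc F.zero)) (inv (F.suc (F.suc F.zero)))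
  where
  byCases : ∀ ρ a b c → V.lookup (a V.∷ b V.∷ c V.∷ V.[]) (V.lookup (oneLine ρ) F.zero) ≡ F.zero →
       V.lookup (a V.∷ b V.∷ c V.∷ V.[]) (V.lookup (oneLine ρ) (F.suc F.zero)) ≡ F.suc F.zero →
       V.lookup (a V.∷ b V.∷ c V.∷ V.[]) (V.lookup (oneLine ρ) (F.suc (F.suc F.zero))) ≡ F.suc (F.suc F.zero) →
       (a V.∷ b V.∷ c V.∷ V.[]) ≡ oneLine (inverse ρ)
  byCases p012 _ _ _ refl refl refl = refl
  byCases p021 _ _ _ refl refl refl = refl
  byCases p102 _ _ _ refl refl refl = refl
  byCases p120 _ _ _ refl refl refl = refl
  byCases p201 _ _ _ refl refl refl = refl
  byCases p210 _ _ _ refl refl refl = refl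

pat-cong : ∀ {s s' : Vec (Fin 3) 3} {x x' y y' : Subset 4} → s ≡ s' → x ≡ x' → y ≡ y' → pat s x y ≡ pat s' x' y'
pat-cong refl refl refl = refl

covered-rev : ∀ p → Covered p → Covered (rev p)
covered-rev _ (ρ , sh , inj₁ refl) = reverse ρ , sh , inj₁ (pat-cong (reverse-oneLine ρ) refl refl)
covered-rev _ (ρ , sh , inj₂ refl) = reverse ρ , mirror sh , inj₂ (pat-cong (reverse-oneLine ρ) (reverse-shapeSet sh) refl)

covered-comp : ∀ p → Covered p → Covered (comp p)
covered-comp _ (ρ , sh , inj₁ refl) = complement ρ , mirror sh , inj₁ (pat-cong (complement-oneLine ρ) refl (reverse-shapeSet sh))
covered-comp _ (ρ , sh , inj₂ refl) = complement ρ , sh , inj₂ (pat-cong (complement-oneLine ρ) refl refl)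

covered-inv : ∀ p q → Covered p → IsInverseOf q p → Covered q
covered-inv _ q (ρ , sh , inj₁ refl) (inv , x≡ , y≡) = inverse ρ , sh , inj₂ (pat-cong (oneLine-inverse ρ (σ q) inv) x≡ y≡)
covered-inv _ q (ρ , sh , inj₂ refl) (inv , x≡ , y≡) = inverse ρ , sh , inj₁ (pat-cong (oneLine-inverse ρ (σ q) inv) x≡ y≡)

symClass-covered : ∀ {b p} → SymClass b p → Covered b → Covered p
symClass-covered base            c = c
symClass-covered (byI {p} {q} s i) c = covered-inv p q (symClass-covered s c) i
symClass-covered (byR {p} s)     c = covered-rev p (symClass-covered s c)
symClass-covered (byC {p} s)     c = covered-comp p (symClass-covered s c)

sixClasses-covered : ∀ p → InTheSixClasses p → Covered p
sixClasses-covered p (inj₁ s)                               = symClass-covered s (p012 , sh012 , inj₁ refl)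
sixClasses-covered p (inj₂ (inj₁ s))                        = symClass-covered s (p012 , sh013 , inj₁ refl)
sixClasses-covered p (inj₂ (inj₂ (inj₁ s)))                 = symClass-covered s (p021 , sh012 , inj₁ refl)
sixClasses-covered p (inj₂ (inj₂ (inj₂ (inj₁ s))))          = symClass-covered s (p021 , sh013 , inj₁ refl)
sixClasses-covered p (inj₂ (inj₂ (inj₂ (inj₂ (inj₁ s)))))   = symClass-covered s (p021 , sh023 , inj₁ refl)
sixClasses-covered p (inj₂ (inj₂ (inj₂ (inj₂ (inj₂ s)))))   = symClass-covered s (p021 , sh123 , inj₁ refl)

containers : ℕ → Pattern 3 → ℕ
containers n p = count n n (λ π → isPerm n π ∧ contains n π p)

containers-covered : ∀ p m → Covered p → 6 * containers (3 + m) p ≡ (3 + m) !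
containers-covered _ m (ρ , sh , inj₁ refl) = count-valuePattern ρ sh m
containers-covered _ m (ρ , sh , inj₂ refl) = count-positionPattern ρ sh m

avoiders+containers : ∀ n p → avoiders n p + containers n p ≡ n !
avoiders+containers n p = trans (countIn-split (isPerm n) (λ π → contains n π p) (seqs n n)) (count-perms n)

five-sixths : ∀ A C N → A + C ≡ N → 6 * C ≡ N → 6 * A ≡ 5 * N
five-sixths A C N split sixth = +-cancelʳ-≡ N (6 * A) (5 * N) (begin
    6 * A + N       ≡⟨ cong (6 * A +_) (sym sixth) ⟩
    6 * A + 6 * C   ≡⟨ sym (*-distribˡ-+ 6 A C) ⟩
    6 * (A + C)     ≡⟨ cong (6 *_) split ⟩
    6 * N           ≡⟨ +-comm N (5 * N) ⟩
    5 * N + N       ∎)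
  where open ≡-Reasoning

mainTheorem15 : (p : Pattern 3) → InTheSixClasses p →
    (n : ℕ) → 3 ≤ n → 6 * avoiders n p ≡ 5 * (n !)
mainTheorem15 p classes (suc (suc (suc m))) _ =
  five-sixths (avoiders n p) (containers n p) (n !) (avoiders+containers n p)
              (containers-covered p m (sixClasses-covered p classes))
  where
  n : ℕ
  n = 3 + m
mainTheorem15 p classes zero                ()
mainTheorem15 p classes (suc zero)          (s≤s ())
mainTheorem15 p classes (suc (suc zero))    (s≤s (s≤s ()))
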